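{- Let $\Sigma$ be a connected $(X,2)$-arc-transitive graph with valency $\mathrm v\ge3$ and let $\Delta$ be a self-paired $X$-orbit on $Arc_3(\Sigma)$ with $\ell_1(\Delta)=1$. If $X$ is faithful on $V(\Sigma)$, then $X_\tau$ is faithful on $\Sigma(\tau)$ for $\tau\in V(\Sigma)$. Let $\mu=|V(\Sigma)|$ and $e=|E(\Sigma)|$. Then $\gimel(\Sigma,\Delta)\cong mC_n$ for some $m,n$ such that: (1) $m\ge\mathrm v(\mathrm v-1)/2$, $n\ge girth(\Sigma)\ge3$ and $mn=\mu\mathrm v(\mathrm v-1)/2=e(\mathrm v-1)$; (2) there exists an $X$-orbit $\mathcal E$ of $n$-cycles of $\Sigma$ with $\Delta=\bigcup_{C\in\mathcal E}Arc_3(C)$ and $|\mathcal E|=m$; (3) $X_{[C]}^{[C]}\cong D_{2n}$ for $C\in\mathcal E$; (4) every $2$-path of $\Sigma$ is contained in a unique member of $\mathcal E$, and either $\Sigma\cong K_{\mathrm v+1}$, or $n\ge girth(\Sigma)\ge4$ and $\Sigma$ is a near $n$-gonal graph with respect to $\mathcal E$.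
   Context: Graphs are finite, simple, undirected; $\Sigma(\tau)$ is a neighbourhood; $mC_n$ is the disjoint union of $m$ cycles of length $n$; $K_{\mathrm v+1}$ is the complete graph. An $s$-arc is a sequence $(\alpha_0,\dots,\alpha_s)$ of vertices with consecutive ones adjacent and $\alpha_{i-1}\ne\alpha_{i+1}$; $Arc_s(\Sigma)$ is the set of $s$-arcs. An $s$-arc with distinct entries, identified with its reverse, is an $s$-path $[\alpha_0,\dots,\alpha_s]$; $Path_2(\Sigma)$ is the set of $2$-paths. $\Sigma$ is $(X,2)$-arc-transitive if $X$ acts on $V(\Sigma)$ preserving adjacency, transitively on vertices and on $2$-arcs. $\Delta$ is self-paired if closed under reversal. For $(\tau_1,\tau,\sigma,\sigma_1)\in\Delta$, $\ell_1(\Delta)$ is the length of the orbit containing $\sigma_1$ of the pointwise stabiliser $X_{(\tau_1,\tau,\sigma)}$ acting on $\Sigma(\sigma)\setminus\{\tau\}$ (independent of the choice). $\gimel(\Sigma,\Delta)$ is the graph with vertex set $Path_2(\Sigma)$ and edges $\{[\alpha_0,\alpha_1,\alpha_2],[\alpha_1,\alpha_2,\alpha_3]\}$ for $(\alpha_0,\alpha_1,\alpha_2,\alpha_3)\in\Delta$. For a subgraph $C$, $X_{[C]}$ is the subgroup of $X$ mapping $C$ onto itself, $X_{[C]}^{[C]}=X_{[C]}/X_{(V(C))}$ with $X_{(V(C))}$ the pointwise stabiliser of $V(C)$; $D_{2n}$ is the dihedral group of order $2n$. A near $n$-gonal graph is a connected graph of girth at least $4$ together with a set $\mathcal E$ of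 $n$-cycles such that each $2$-arc is contained in a unique member of $\mathcal E$. -}

module Defs where

open import Level using (Level; _⊔_)
open import Algebra.Bundles using (Group)
open import Data.Nat using (ℕ; zero; suc; _+_; _*_; _∸_; _≤_; _<_; _<ᵇ_)
open import Data.Nat.DivMod using (_mod_; _/_)
open import Data.Fin using (Fin; zero; suc; toℕ)
open import Data.Bool using (Bool; true; false; T; _∧_; if_then_else_; _xor_)
open import Data.Product using (Σ; ∃; ∃-syntax; _×_; _,_; proj₁; proj₂)
open import Data.Sum using (_⊎_)
open import Relation.Binary.PropositionalEquality using (_≡_; _≢_)
open import Relation.Nullary using (¬_)
open import Function.Bundles using (_⇔_)
open import Function.Definitions using (Bijective)

countB : ∀ {N} → (Fin N → Bool) → ℕ
countB {zero} f = 0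
countB {suc N} f = (if f zero then 1 else 0) + countB (λ i → f (suc i))

sumF : ∀ {N} → (Fin N → ℕ) → ℕ
sumF {zero} f = 0
sumF {suc N} f = f zero + sumF (λ i → f (suc i))

addF : ∀ {n} → Fin n → Fin n → Fin n
addF {zero} () b
addF {suc k} a b = (toℕ a + toℕ b) mod suc k

negF : ∀ {n} → Fin n → Fin n
negF {zero} ()
negF {suc k} a = (suc k ∸ toℕ a) mod suc k

nextF : ∀ {n} → Fin n → Fin n
nextF {zero} ()
nextF {suc k} a = suc (toℕ a) mod suc k

-- Dihedral group D_{2n}: element (k , s) stands for r^k t^s
-- (r a rotation of order n, t a reflection, t r t = r⁻¹).

Dih : ℕ → Set
Dih n = Fin n × Bool

dmul : ∀ {n} → Dih n → Dih n → Dih n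
dmul (k₁ , s₁) (k₂ , s₂) = addF k₁ (if s₁ then negF k₂ else k₂) , (s₁ xor s₂)

GraphIso : (A B : Set) → (A → A → Set) → (B → B → Set) → Set
GraphIso A B RA RB =
  ∃[ f ] (Bijective _≡_ _≡_ f × (∀ x y → RA x y ⇔ RB (f x) (f y)))

KAdj : ∀ {k} → Fin k → Fin k → Set
KAdj x y = x ≢ y

mCnAdj : ∀ {m n} → Fin m × Fin n → Fin m × Fin n → Set
mCnAdj (i , j) (i' , j') = i ≡ i' × (j' ≡ nextF j ⊎ j ≡ nextF j')

record Graph (N : ℕ) : Set where
  field
    adj : Fin N → Fin N → Bool
    adj-sym : ∀ u w → adj u w ≡ adj w u
    adj-irr : ∀ u → adj u u ≡ false

Quad : ℕ → Set
Quad N = Fin N × Fin N × Fin N × Fin N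

Triple : ℕ → Set
Triple N = Fin N × Fin N × Fin N

-- an edge set of a subgraph, as a Bool-valued relation
EdgeSet : ℕ → Set
EdgeSet N = Fin N → Fin N → Bool

module _ {N : ℕ} (Γ : Graph N) where
  open Graph Γ

  Adj : Fin N → Fin N → Set
  Adj u w = T (adj u w)

  data Reach : Fin N → Fin N → Set where
    here : ∀ {u} → Reach u u
    step : ∀ {u w x} → Adj u w → Reach w x → Reach u x

  Connected : Set
  Connected = ∀ u w → Reach u w

  degree : Fin N → ℕ
  degree τ = countB (adj τ)

  Regular : ℕ → Set
  Regular v = ∀ τ → degree τ ≡ v

  -- |E(Σ)|: edges {u,w} counted once, via u < w
  numEdges : ℕ
  numEdges = sumF (λ u → countB (λ w → adj u w ∧ (toℕ u <ᵇ toℕ w)))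

  Arc2 : Triple N → Set
  Arc2 (a , b , c) = Adj a b × Adj b c × a ≢ c

  Arc3 : Quad N → Set
  Arc3 (a , b , c , d) = Adj a b × Adj b c × Adj c d × a ≢ c × b ≢ d

  HasCycle : ℕ → Set
  HasCycle k = 3 ≤ k × Σ (Fin k → Fin N) λ c →
    (∀ i j → c i ≡ c j → i ≡ j) × (∀ i → Adj (c i) (c (nextF i)))

  IsGirth : ℕ → Set
  IsGirth g = HasCycle g × (∀ k → k < g → ¬ HasCycle k)

  IsNCycle : ℕ → EdgeSet N → Set
  IsNCycle n E = 3 ≤ n × Σ (Fin n → Fin N) λ c →
    (∀ i j → c i ≡ c j → i ≡ j) × (∀ i → Adj (c i) (c (nextF i))) ×
    (∀ u w → T (E u w) ⇔
       (∃[ i ] ((u ≡ c i × w ≡ c (nextF i)) ⊎ (w ≡ c i × u ≡ c (nextF i)))))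

  InV : EdgeSet N → Fin N → Set
  InV E u = ∃[ w ] T (E u w)

  Arc3In : EdgeSet N → Quad N → Set
  Arc3In E (a , b , c , d) =
    T (E a b) × T (E b c) × T (E c d) × a ≢ c × b ≢ d

  PathIn : EdgeSet N → Triple N → Set
  PathIn E (a , b , c) = T (E a b) × T (E b c)

  -- Path₂(Σ): 2-paths, each represented by its unique orientation
  -- [a,b,c] with a < c (2-path = 2-arc up to reversal)
  isP2 : Triple N → Bool
  isP2 (a , b , c) = adj a b ∧ adj b c ∧ (toℕ a <ᵇ toℕ c)

  Path2 : Set
  Path2 = Σ (Triple N) (λ t → T (isP2 t))

  SamePath : Triple N → Triple N → Set
  SamePath (a , b , c) (x , y , z) = (a , b , c) ≡ (x , y , z) ⊎ (a , b , c) ≡ (z , y , x)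

  -- adjacency of ℷ(Σ,Δ): {[α0,α1,α2],[α1,α2,α3]} for (α0,α1,α2,α3) ∈ Δ
  GimelAdj : (Quad N → Set) → Path2 → Path2 → Set
  GimelAdj Δ P Q = ∃[ α ] (Δ α × (E₁ α P Q ⊎ E₁ α Q P))
    where
    E₁ : Quad N → Path2 → Path2 → Set
    E₁ (a₀ , a₁ , a₂ , a₃) P Q =
      SamePath (proj₁ P) (a₀ , a₁ , a₂) × SamePath (proj₁ Q) (a₁ , a₂ , a₃)

  UniqueContainment : ∀ {m} → (Fin m → EdgeSet N) → Set
  UniqueContainment {m} ℰ = ∀ t → Arc2 t →
    Σ (Fin m) λ i → PathIn (ℰ i) t × (∀ j → PathIn (ℰ j) t → j ≡ i)

  NearPolygonal : ∀ {m} → ℕ → (Fin m → EdgeSet N) → Set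
  NearPolygonal n ℰ =
    Connected × (∃[ g ] (IsGirth g × 4 ≤ g)) ×
    (∀ i → IsNCycle n (ℰ i)) × UniqueContainment ℰ

record Action {c ℓ} (X : Group c ℓ) {N : ℕ} (Γ : Graph N) : Set (c ⊔ ℓ) where
  open Group X
  field
    act : Carrier → Fin N → Fin N
    act-ε : ∀ v → act ε v ≡ v
    act-∙ : ∀ g h v → act (g ∙ h) v ≡ act g (act h v)
    act-≈ : ∀ {g h} → g ≈ h → ∀ v → act g v ≡ act h v
    act-adj : ∀ g u w → Adj Γ u w → Adj Γ (act g u) (act g w)

module _ {c ℓ} {X : Group c ℓ} {N : ℕ} {Γ : Graph N} (A : Action X Γ) where
  open Group X
  open Action A

  act3 : Carrier → Triple N → Triple N
  act3 g (a , b , c) = act g a , act g b , act g c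

  act4 : Carrier → Quad N → Quad N
  act4 g (a , b , c , d) = act g a , act g b , act g c , act g d

  VertexTransitive : Set c
  VertexTransitive = ∀ u w → ∃[ g ] act g u ≡ w

  TwoArcTransitive : Set c
  TwoArcTransitive = ∀ s t → Arc2 Γ s → Arc2 Γ t → ∃[ g ] act3 g s ≡ t

  FaithfulOnV : Set (c ⊔ ℓ)
  FaithfulOnV = ∀ g → (∀ v → act g v ≡ v) → g ≈ ε

  StabFaithfulOnNbhd : Set (c ⊔ ℓ)
  StabFaithfulOnNbhd = ∀ τ g → act g τ ≡ τ →
    (∀ w → Adj Γ τ w → act g w ≡ w) → g ≈ ε

  IsArc3Orbit : (Quad N → Set) → Set c
  IsArc3Orbit Δ = ∃[ δ ] (Arc3 Γ δ × (∀ α → Δ α ⇔ (∃[ g ] α ≡ act4 g δ)))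

  SelfPaired : (Quad N → Set) → Set
  SelfPaired Δ = ∀ a b c d → Δ (a , b , c , d) → Δ (d , c , b , a)

  -- ℓ₁(Δ) = 1: the stabiliser X_(τ₁,τ,σ) fixes σ₁, for (τ₁,τ,σ,σ₁) ∈ Δ
  Ell1IsOne : (Quad N → Set) → Set c
  Ell1IsOne Δ = ∀ τ₁ τ σ σ₁ → Δ (τ₁ , τ , σ , σ₁) → ∀ g →
    act g τ₁ ≡ τ₁ → act g τ ≡ τ → act g σ ≡ σ → act g σ₁ ≡ σ₁

  MapsOnto : Carrier → EdgeSet N → EdgeSet N → Set
  MapsOnto g C D = ∀ u w → C u w ≡ D (act g u) (act g w)

  IsOrbitFamily : ∀ {m} → (Fin m → EdgeSet N) → Set c
  IsOrbitFamily {m} ℰ =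
    (∀ g i → ∃[ j ] MapsOnto g (ℰ i) (ℰ j)) ×
    (∀ i j → ∃[ g ] MapsOnto g (ℰ i) (ℰ j))

  -- X_[C]^[C] = X_[C] / X_(V(C)) ≅ D_{2n}: a homomorphism φ from X_[C]
  -- onto D_{2n} whose fibres are exactly the cosets of X_(V(C))
  InducedDihedral : ℕ → EdgeSet N → Set c
  InducedDihedral n C =
    Σ ((g : Carrier) → MapsOnto g C C → Dih n) λ φ →
      (∀ g h pg ph pgh → φ (g ∙ h) pgh ≡ dmul (φ g pg) (φ h ph)) ×
      (∀ g h pg ph → (φ g pg ≡ φ h ph) ⇔ (∀ v → InV Γ C v → act g v ≡ act h v)) ×
      (∀ d → ∃[ g ] Σ (MapsOnto g C C) λ pg → φ g pg ≡ d)

module Submission where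

open import Defs
open import Level using (_⊔_) renaming (suc to lsuc)
open import Algebra.Bundles using (Group)
open import Data.Nat using (ℕ; zero; suc; _+_; _*_; _∸_; _≤_; _<_; _<ᵇ_; z≤n; s≤s; _≤?_; _<?_; NonZero; >-nonZero; >-nonZero⁻¹; <-cmp)
open import Data.Nat.Properties
open import Data.Nat.DivMod using (_%_; _/_; _mod_; m%n<n; m≡m%n+[m/n]*n; [m+kn]%n≡m%n; %-distribˡ-+; m%n%n≡m%n; m<n⇒m%n≡m; n%n≡0; m*n/n≡m)
open import Data.Nat.Tactic.RingSolver using (solve-∀)
open import Data.Fin using (Fin; zero; suc; toℕ)
import Data.Fin as F
import Data.Fin.Properties as FP
open import Data.Fin.Permutation using (↔⇒≡)
open import Data.Bool using (Bool; true; false; T; _∧_; not; if_then_else_; _xor_)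
open import Data.Bool.Properties using (T?; T-irrelevant; T-∧; T-≡)
open import Data.Product using (Σ; ∃; ∃-syntax; _×_; _,_; proj₁; proj₂)
import Data.Product.Properties as PP
open import Data.Product.Function.NonDependent.Propositional using (_×-↔_)
open import Data.Product.Function.Dependent.Propositional using (Σ-↔)
open import Data.Sum using (_⊎_; inj₁; inj₂)
open import Data.Sum.Function.Propositional using (_⊎-↔_)
open import Data.Empty using (⊥; ⊥-elim)
open import Data.List using (upTo)
open import Data.List.Extrema.Nat using (argmin; argmin-sel; f[argmin]≤f[xs])
open import Data.List.Membership.Propositional.Properties using (∈-upTo⁺; ∈-upTo⁻)
import Data.List.Relation.Unary.All as All
open import Function using (_∘_)
open import Function.Bundles using (_↔_; _⇔_; Inverse; Equivalence; mk↔ₛ′; mk⇔)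
open import Function.Definitions using (Bijective)
open import Function.Properties.Inverse using (↔-refl; ↔-sym; ↔-trans)
open import Relation.Binary.Definitions using (tri<; tri≈; tri>)
open import Relation.Binary.PropositionalEquality
open import Relation.Nullary using (¬_; Dec; yes; no; does; _×-dec_; _⊎-dec_; _→-dec_; ¬?)
open import Relation.Nullary.Decidable using (⌊_⌋; toWitness; fromWitness; dec-true; dec-false)

-- Since ℓ₁(Δ) = 1, every 2-arc (a,b,c) has exactly one extension
-- (a,b,c,d) ∈ Δ, giving an X-equivariant successor map next (a,b,c) = (b,c,d);
-- self-pairedness makes reversal conjugate next to its inverse.  Iterating next
-- from any 2-arc gives a Δ-walk; all Δ-walks have the same least period n ≥ 3
-- and their first n vertices are distinct, so each spans an n-cycle.  Choosing
-- the 2-path of least code on each cycle enumerates the cycles as ℰ 0 … ℰ (m-1),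
-- and (cycle, position) identifies Path₂(Γ) with Fin m × Fin n, turning ℷ(Γ,Δ)
-- into m C_n.  Counting 2-paths by their middle vertex and arcs by edges gives
-- the numerical part; the stabiliser of a cycle acts on it as D_{2n}; and a
-- stabiliser-faithfulness, girth and near-polygonality argument gives the rest.

module FiniteCounting where

  ∧-split : ∀ a {b} → T (a ∧ b) → T a × T b
  ∧-split a = Equivalence.to (T-∧ {a})

  ∧-pair : ∀ {a b} → T a → T b → T (a ∧ b)
  ∧-pair p q = Equivalence.from T-∧ (p , q)

  T-extensional : ∀ {a b : Bool} → (T a → T b) → (T b → T a) → a ≡ b
  T-extensional {false} {false} f g = refl
  T-extensional {false} {true} f g = ⊥-elim (g _)
  T-extensional {true} {false} f g = ⊥-elim (f _)
  T-extensional {true} {true} f g = refl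

  Σ-T-≡ : ∀ {A : Set} {P : A → Bool} {a b : A} {p : T (P a)} {q : T (P b)} →
    a ≡ b → _≡_ {A = Σ A (T ∘ P)} (a , p) (b , q)
  Σ-T-≡ refl = cong (_ ,_) (T-irrelevant _ _)

  T-↔ : ∀ b → T b ↔ Fin (if b then 1 else 0)
  T-↔ true = mk↔ₛ′ (λ _ → zero) (λ _ → _) (λ { zero → refl }) (λ _ → refl)
  T-↔ false = mk↔ₛ′ (λ ()) (λ ()) (λ ()) (λ ())

  Σ-Fin-↔ : ∀ {N} (P : Fin N → Set) (s : Fin N → ℕ) →
    (∀ a → P a ↔ Fin (s a)) → Σ (Fin N) P ↔ Fin (sumF s)
  Σ-Fin-↔ {zero} P s e = mk↔ₛ′ (λ ()) (λ ()) (λ ()) (λ ())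
  Σ-Fin-↔ {suc N} P s e =
    ↔-trans peel (↔-trans (e zero ⊎-↔ Σ-Fin-↔ (P ∘ suc) (s ∘ suc) (e ∘ suc)) (↔-sym FP.+↔⊎))
    where
    peel : Σ (Fin (suc N)) P ↔ (P zero ⊎ Σ (Fin N) (P ∘ suc))
    peel = mk↔ₛ′ (λ { (zero , p) → inj₁ p ; (suc a , p) → inj₂ (a , p) })
                 (λ { (inj₁ p) → zero , p ; (inj₂ (a , p)) → suc a , p })
                 (λ { (inj₁ _) → refl ; (inj₂ _) → refl })
                 (λ { (zero , _) → refl ; (suc _ , _) → refl })

  countB-as-sum : ∀ {N} (f : Fin N → Bool) → countB f ≡ sumF (λ a → if f a then 1 else 0)
  countB-as-sum {zero} f = refl
  countB-as-sum {suc N} f = cong ((if f zero then 1 else 0) +_) (countB-as-sum (f ∘ suc))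

  countB-↔ : ∀ {N} (f : Fin N → Bool) → Σ (Fin N) (T ∘ f) ↔ Fin (countB f)
  countB-↔ f = subst (λ k → Σ _ (T ∘ f) ↔ Fin k) (sym (countB-as-sum f))
                     (Σ-Fin-↔ (T ∘ f) _ (T-↔ ∘ f))

  count-↔ : ∀ {A : Set} {K} (e : A ↔ Fin K) (p : A → Bool) →
    Σ A (T ∘ p) ↔ Fin (countB (p ∘ Inverse.from e))
  count-↔ e p = ↔-trans (Σ-↔ e λ {a} → subst (λ b → T (p a) ↔ T (p b))
                                        (sym (Inverse.strictlyInverseʳ e a)) ↔-refl)
                        (countB-↔ (p ∘ Inverse.from e))

  ↔-injective : ∀ {A B : Set} (e : A ↔ B) {x y} → Inverse.to e x ≡ Inverse.to e y → x ≡ y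
  ↔-injective e {x} {y} p = trans (sym (Inverse.strictlyInverseʳ e x))
    (trans (cong (Inverse.from e) p) (Inverse.strictlyInverseʳ e y))

  ↔-bijective : ∀ {A B : Set} (e : A ↔ B) → Bijective _≡_ _≡_ (Inverse.to e)
  ↔-bijective e = ↔-injective e , λ y → Inverse.from e y , λ { refl → Inverse.strictlyInverseˡ e y }

  Triple-↔ : ∀ N → Triple N ↔ Fin (N * (N * N))
  Triple-↔ N = ↔-sym (↔-trans FP.*↔× (↔-refl ×-↔ FP.*↔×))

  sumF-cong : ∀ {N} {f g : Fin N → ℕ} → (∀ i → f i ≡ g i) → sumF f ≡ sumF g
  sumF-cong {zero} e = refl
  sumF-cong {suc N} e = cong₂ _+_ (e zero) (sumF-cong (e ∘ suc))

  countB-cong : ∀ {N} {f g : Fin N → Bool} → (∀ i → f i ≡ g i) → countB f ≡ countB g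
  countB-cong {N} {f} {g} e =
    trans (countB-as-sum f) (trans (sumF-cong (λ i → cong (λ b → if b then 1 else 0) (e i)))
                                   (sym (countB-as-sum g)))

  sumF-const : ∀ N v → sumF {N} (λ _ → v) ≡ N * v
  sumF-const zero v = refl
  sumF-const (suc N) v = cong (v +_) (sumF-const N v)

  countB-complement : ∀ {N} (f : Fin N → Bool) → countB f + countB (not ∘ f) ≡ N
  countB-complement {zero} f = refl
  countB-complement {suc N} f with f zero | countB-complement (f ∘ suc)
  ... | true | ih = cong suc ih
  ... | false | ih = trans (+-suc _ _) (cong suc ih)

  countB-singleton : ∀ {N} (τ : Fin N) (f : Fin N → Bool) →
    (∀ w → T (f w) → w ≡ τ) → T (f τ) → countB f ≡ 1
  countB-singleton {N} τ f only hit = ↔⇒≡ (↔-trans (↔-sym (countB-↔ f)) single)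
    where
    single : Σ (Fin N) (T ∘ f) ↔ Fin 1
    single = mk↔ₛ′ (λ _ → zero) (λ _ → τ , hit) (λ { zero → refl })
                   (λ { (w , p) → Σ-T-≡ (sym (only w p)) })

  pairs : ∀ {N} → (Fin N → Bool) → ℕ
  pairs f = sumF (λ a → countB (λ c → f a ∧ (f c ∧ (toℕ a <ᵇ toℕ c))))

  countB-false : ∀ {N} → countB {N} (λ _ → false) ≡ 0
  countB-false {zero} = refl
  countB-false {suc N} = countB-false {N}

  pairs-suc : ∀ {N} (f : Fin (suc N) → Bool) →
    pairs f ≡ (if f zero then countB (f ∘ suc) else 0) + pairs (f ∘ suc)
  pairs-suc {N} f = cong₂ _+_ withZero (sumF-cong withoutZero)
    where
    withZero : countB (λ c → f zero ∧ (f c ∧ (0 <ᵇ toℕ c))) ≡ (if f zero then countB (f ∘ suc) else 0)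
    withZero with f zero
    ... | true = countB-cong (λ i → ∧-true (f (suc i)))
      where
      ∧-true : ∀ b → (b ∧ true) ≡ b
      ∧-true true = refl
      ∧-true false = refl
    ... | false = countB-false {N}
    withoutZero : ∀ a → countB (λ c → f (suc a) ∧ (f c ∧ (toℕ (suc a) <ᵇ toℕ c)))
                      ≡ countB (λ c → f (suc a) ∧ (f (suc c) ∧ (toℕ a <ᵇ toℕ c)))
    withoutZero a with f (suc a) | f zero
    ... | true | true = refl
    ... | true | false = refl
    ... | false | _ = refl

  pairs-count : ∀ {N} (f : Fin N → Bool) → 2 * pairs f ≡ countB f * (countB f ∸ 1)
  pairs-count {zero} f = refl
  pairs-count {suc N} f rewrite pairs-suc f with f zero
  ... | false = pairs-count (f ∘ suc)
  ... | true = begin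
      2 * (K + pairs (f ∘ suc))         ≡⟨ *-distribˡ-+ 2 K _ ⟩
      2 * K + 2 * pairs (f ∘ suc)       ≡⟨ cong (2 * K +_) (pairs-count (f ∘ suc)) ⟩
      2 * K + K * (K ∸ 1)               ≡⟨ arith K ⟩
      suc K * K                         ∎
    where
    open ≡-Reasoning
    K : ℕ
    K = countB (f ∘ suc)
    arith : ∀ K → 2 * K + K * (K ∸ 1) ≡ suc K * K
    arith zero = refl
    arith (suc k) = lemma k
      where
      lemma : ∀ k → 2 * suc k + suc k * k ≡ suc (suc k) * suc k
      lemma = solve-∀

  least : (P : ℕ → Set) → (∀ k → Dec (P k)) → ∀ n → P n →
    Σ ℕ λ g → P g × g ≤ n × (∀ k → k < g → ¬ P k)
  least P P? n pn = go 0 n (λ k ()) refl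
    where
    go : ∀ i r → (∀ k → k < i → ¬ P k) → i + r ≡ n →
      Σ ℕ λ g → P g × g ≤ n × (∀ k → k < g → ¬ P k)
    go i r below eq with P? i
    ... | yes pi = i , pi , subst (i ≤_) eq (m≤m+n i r) , below
    go i zero below eq | no ¬pi = ⊥-elim (¬pi (subst P (trans (sym eq) (+-identityʳ i)) pn))
    go i (suc r) below eq | no ¬pi = go (suc i) r below′ (trans (sym (+-suc i r)) eq)
      where
      below′ : ∀ k → k < suc i → ¬ P k
      below′ k (s≤s k≤i) with m≤n⇒m<n∨m≡n k≤i
      ... | inj₁ k<i = below k k<i
      ... | inj₂ refl = ¬pi

  argmin-below : ∀ n → 1 ≤ n → (f : ℕ → ℕ) → Σ ℕ λ i → i < n × (∀ j → j < n → f i ≤ f j)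
  argmin-below n 1≤n f = i , inRange (argmin-sel f 0 (upTo n)) ,
    λ j j<n → All.lookup (f[argmin]≤f[xs] 0 (upTo n)) (∈-upTo⁺ j<n)
    where
    i : ℕ
    i = argmin f 0 (upTo n)
    inRange : _ → i < n
    inRange (inj₁ i≡0) = subst (_< n) (sym i≡0) 1≤n
    inRange (inj₂ i∈) = ∈-upTo⁻ i∈

  dec-∃-function : ∀ k {N} (P : (Fin k → Fin N) → Set) →
    (∀ f g → (∀ i → f i ≡ g i) → P f → P g) → (∀ f → Dec (P f)) →
    Dec (Σ (Fin k → Fin N) P)
  dec-∃-function zero P resp P? with P? (λ ())
  ... | yes p = yes ((λ ()) , p)
  ... | no ¬p = no λ { (f , p) → ¬p (resp f (λ ()) (λ ()) p) }
  dec-∃-function (suc k) {N} P resp P?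
    with FP.any? (λ a → dec-∃-function k (P ∘ cons a)
                          (λ f g e → resp _ _ (λ { zero → refl ; (suc i) → e i }))
                          (P? ∘ cons a))
    where
    cons : Fin N → (Fin k → Fin N) → Fin (suc k) → Fin N
    cons a f zero = a
    cons a f (suc i) = f i
  ... | yes (a , f , p) = yes (_ , p)
  ... | no ¬p = no λ { (f , p) → ¬p (f zero , f ∘ suc ,
                         resp f _ (λ { zero → refl ; (suc i) → refl }) p) }

module Congruence (n : ℕ) {{n≢0 : NonZero n}} where

  infix 4 _≋_
  _≋_ : ℕ → ℕ → Set
  a ≋ b = a % n ≡ b % n

  ≡⇒≋ : ∀ {a b} → a ≡ b → a ≋ b
  ≡⇒≋ refl = refl

  ≋-+ : ∀ {a b c d} → a ≋ b → c ≋ d → (a + c) ≋ (b + d)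
  ≋-+ {a} {b} {c} {d} e f =
    trans (%-distribˡ-+ a c n) (trans (cong₂ (λ p q → (p + q) % n) e f) (sym (%-distribˡ-+ b d n)))

  ≋-+ˡ : ∀ k {c d} → c ≋ d → (k + c) ≋ (k + d)
  ≋-+ˡ k = ≋-+ {k} {k} refl

  ≋-kn : ∀ a k → (a + k * n) ≋ a
  ≋-kn a k = [m+kn]%n≡m%n a k n

  ≋-mod : ∀ a → (a % n) ≋ a
  ≋-mod a = m%n%n≡m%n a n

  1≤n : 1 ≤ n
  1≤n = >-nonZero⁻¹ n

  -- ν = n - 1 represents -1 modulo n.
  ν : ℕ
  ν = n ∸ 1

  suc-ν : suc ν ≡ n
  suc-ν = m+[n∸m]≡n 1≤n

  ν<n : ν < n
  ν<n = subst (ν <_) suc-ν (n<1+n ν)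

  ν*-inverse : ∀ c → (ν * c + c) ≋ 0
  ν*-inverse c = trans (cong (_% n) ν*c+c≡c*n) (≋-kn 0 c)
    where
    ν*c+c≡c*n : ν * c + c ≡ c * n
    ν*c+c≡c*n = trans (+-comm (ν * c) c) (trans (cong (_* c) suc-ν) (*-comm n c))

  ν*-inverseˡ : ∀ c → (c + ν * c) ≋ 0
  ν*-inverseˡ c = trans (cong (_% n) (+-comm c (ν * c))) (ν*-inverse c)

  ≋-cancel : ∀ {a b} c → (a + c) ≋ (b + c) → a ≋ b
  ≋-cancel {a} {b} c e = begin
      a % n                    ≡⟨ cong (_% n) (sym (+-identityʳ a)) ⟩
      (a + 0) % n              ≡⟨ ≋-+ˡ a (sym (ν*-inverseˡ c)) ⟩
      (a + (c + ν * c)) % n    ≡⟨ cong (_% n) (sym (+-assoc a c _)) ⟩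
      (a + c + ν * c) % n      ≡⟨ ≋-+ e (refl {x = (ν * c) % n}) ⟩
      (b + c + ν * c) % n      ≡⟨ cong (_% n) (+-assoc b c _) ⟩
      (b + (c + ν * c)) % n    ≡⟨ ≋-+ˡ b (ν*-inverseˡ c) ⟩
      (b + 0) % n              ≡⟨ cong (_% n) (+-identityʳ b) ⟩
      b % n                    ∎
    where
    open ≡-Reasoning

  ν*ν* : ∀ j → (ν * (ν * j)) ≋ j
  ν*ν* j = ≋-cancel (ν * j) (trans (ν*-inverse (ν * j))
             (sym (trans (≡⇒≋ (+-comm j (ν * j))) (ν*-inverse j))))

  ν*≋∸ : ∀ k → k ≤ n → (ν * k) ≋ (n ∸ k)
  ν*≋∸ k k≤n = ≋-cancel k (trans (ν*-inverse k)
    (sym (trans (cong (_% n) (m∸n+n≡m k≤n)) (trans (n%n≡0 n) (sym (m<n⇒m%n≡m 1≤n))))))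

  offset : ℕ → ℕ → ℕ
  offset a b = b + a * ν

  offset-≋ : ∀ a b → (a + offset a b) ≋ b
  offset-≋ a b = trans (≡⇒≋ (trans (cong (a +_) (+-comm b _)) (sym (+-assoc a _ b))))
                       (≋-+ (trans (≡⇒≋ (cong (a +_) (*-comm a ν))) (ν*-inverseˡ a)) (refl {x = b % n}))

  prev : ℕ → ℕ
  prev q = q + ν

  suc-prev : ∀ q → suc (prev q) ≋ q
  suc-prev q = trans (≡⇒≋ (trans (sym (+-suc q ν)) (cong (q +_) (trans suc-ν (sym (*-identityˡ n))))))
                     (≋-kn q 1)

  prev-suc : ∀ q → prev (suc q) ≋ q
  prev-suc q = ≋-cancel 1 (trans (≡⇒≋ (+-comm (prev (suc q)) 1))
                                 (trans (suc-prev (suc q)) (≡⇒≋ (+-comm 1 q))))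

  toℕ-mod : ∀ a → toℕ (a mod n) ≡ a % n
  toℕ-mod a = FP.toℕ-fromℕ< _

  Fin-≋ : ∀ (i j : Fin n) → toℕ i ≋ toℕ j → i ≡ j
  Fin-≋ i j e = FP.toℕ-injective
    (trans (sym (m<n⇒m%n≡m (FP.toℕ<n i))) (trans e (m<n⇒m%n≡m (FP.toℕ<n j))))

  nextF-toℕ : ∀ {m} {{_ : NonZero m}} (i : Fin m) → toℕ (nextF i) ≡ suc (toℕ i) % m
  nextF-toℕ {suc k} i = FP.toℕ-fromℕ< _

  addF-toℕ : ∀ {m} {{_ : NonZero m}} (a b : Fin m) → toℕ (addF a b) ≡ (toℕ a + toℕ b) % m
  addF-toℕ {suc k} a b = FP.toℕ-fromℕ< _

  negF-toℕ : ∀ {m} {{_ : NonZero m}} (a : Fin m) → toℕ (negF a) ≡ (m ∸ toℕ a) % m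
  negF-toℕ {suc k} a = FP.toℕ-fromℕ< _

  nextF-mod : ∀ (j : Fin n) → nextF j ≡ suc (toℕ j) mod n
  nextF-mod j = FP.toℕ-injective (trans (nextF-toℕ j) (sym (toℕ-mod (suc (toℕ j)))))

  nextF-prev : ∀ (j : Fin n) → nextF (prev (toℕ j) mod n) ≡ j
  nextF-prev j = Fin-≋ _ j (begin
      toℕ (nextF y) % n      ≡⟨ cong (_% n) (nextF-toℕ y) ⟩
      suc (toℕ y) % n % n    ≡⟨ ≋-mod (suc (toℕ y)) ⟩
      suc (toℕ y) % n        ≡⟨ ≋-+ˡ 1 (trans (cong (_% n) (toℕ-mod (prev (toℕ j)))) (≋-mod _)) ⟩
      suc (prev (toℕ j)) % n ≡⟨ suc-prev (toℕ j) ⟩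
      toℕ j % n              ∎)
    where
    open ≡-Reasoning
    y : Fin n
    y = prev (toℕ j) mod n

  addF-≋ : ∀ (a b : Fin n) → toℕ (addF a b) ≋ (toℕ a + toℕ b)
  addF-≋ a b = trans (cong (_% n) (addF-toℕ a b)) (≋-mod _)

  addF-negF-≋ : ∀ (a b : Fin n) → toℕ (addF a (negF b)) ≋ (toℕ a + (n ∸ toℕ b))
  addF-negF-≋ a b = trans (addF-≋ a (negF b))
    (≋-+ˡ (toℕ a) (trans (cong (_% n) (negF-toℕ b)) (≋-mod _)))

  -- The dihedral group on the residues: j ↦ k + j (rotation) and
  -- j ↦ k - j (reflection), composed as in dmul.

  dihedralMap : Bool → ℕ → ℕ → ℕ
  dihedralMap false k j = k + j
  dihedralMap true k j = k + ν * j

  dihedralMap-0 : ∀ s k → dihedralMap s k 0 ≡ k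
  dihedralMap-0 false k = +-identityʳ k
  dihedralMap-0 true k = trans (cong (k +_) (*-zeroʳ ν)) (+-identityʳ k)

  dihedralMap-∘ : ∀ s (k : Fin n) s′ (k′ : Fin n) j →
    dihedralMap s (toℕ k) (dihedralMap s′ (toℕ k′) j)
      ≋ dihedralMap (s xor s′) (toℕ (addF k (if s then negF k′ else k′))) j
  dihedralMap-∘ false k false k′ j =
    trans (≡⇒≋ (sym (+-assoc (toℕ k) (toℕ k′) j))) (sym (≋-+ (addF-≋ k k′) (refl {x = j % n})))
  dihedralMap-∘ false k true k′ j =
    trans (≡⇒≋ (sym (+-assoc (toℕ k) (toℕ k′) (ν * j)))) (sym (≋-+ (addF-≋ k k′) (refl {x = (ν * j) % n})))
  dihedralMap-∘ true k false k′ j = begin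
      (a + ν * (b + j)) % n       ≡⟨ cong (_% n) (expand a ν b j) ⟩
      (a + ν * j + ν * b) % n     ≡⟨ ≋-+ˡ (a + ν * j) (ν*≋∸ b (<⇒≤ (FP.toℕ<n k′))) ⟩
      (a + ν * j + (n ∸ b)) % n   ≡⟨ cong (_% n) (swap a (ν * j) (n ∸ b)) ⟩
      (a + (n ∸ b) + ν * j) % n   ≡⟨ sym (≋-+ (addF-negF-≋ k k′) (refl {x = (ν * j) % n})) ⟩
      (toℕ (addF k (negF k′)) + ν * j) % n ∎
    where
    open ≡-Reasoning
    a b : ℕ
    a = toℕ k
    b = toℕ k′
    expand : ∀ a ν b j → a + ν * (b + j) ≡ a + ν * j + ν * b
    expand = solve-∀
    swap : ∀ a x y → a + x + y ≡ a + y + x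
    swap = solve-∀
  dihedralMap-∘ true k true k′ j = begin
      (a + ν * (b + ν * j)) % n     ≡⟨ cong (_% n) (expand a ν b j) ⟩
      (a + ν * b + ν * (ν * j)) % n ≡⟨ ≋-+ (≋-+ˡ a (ν*≋∸ b (<⇒≤ (FP.toℕ<n k′)))) (ν*ν* j) ⟩
      (a + (n ∸ b) + j) % n         ≡⟨ sym (≋-+ (addF-negF-≋ k k′) (refl {x = j % n})) ⟩
      (toℕ (addF k (negF k′)) + j) % n ∎
    where
    open ≡-Reasoning
    a b : ℕ
    a = toℕ k
    b = toℕ k′
    expand : ∀ a ν b j → a + ν * (b + ν * j) ≡ a + ν * b + ν * (ν * j)
    expand = solve-∀

module GraphFacts {N : ℕ} (Γ : Graph N) where
  open Graph Γ
  open FiniteCounting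

  Adj-sym : ∀ {u w} → Adj Γ u w → Adj Γ w u
  Adj-sym {u} {w} = subst T (adj-sym u w)

  Adj-irrefl : ∀ {u} → ¬ Adj Γ u u
  Adj-irrefl {u} = subst T (adj-irr u)

  Adj⇒≢ : ∀ {u w} → Adj Γ u w → u ≢ w
  Adj⇒≢ p refl = Adj-irrefl p

  rev : Triple N → Triple N
  rev t = proj₂ (proj₂ t) , proj₁ (proj₂ t) , proj₁ t

  Arc2-rev : ∀ {t} → Arc2 Γ t → Arc2 Γ (rev t)
  Arc2-rev (p , q , a≢c) = Adj-sym q , Adj-sym p , a≢c ∘ sym

  Arc2? : ∀ t → Dec (Arc2 Γ t)
  Arc2? (a , b , c) = T? (adj a b) ×-dec T? (adj b c) ×-dec ¬? (a F.≟ c)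

  _≟₃_ : (s t : Triple N) → Dec (s ≡ t)
  _≟₃_ = PP.≡-dec F._≟_ (PP.≡-dec F._≟_ F._≟_)

  before : Fin N → Fin N → Bool
  before a c = toℕ a <ᵇ toℕ c

  ascending : Triple N → Bool
  ascending t = before (proj₁ t) (proj₂ (proj₂ t))

  orient : Triple N → Triple N
  orient t = if ascending t then t else rev t

  orient-cases : ∀ t → (T (ascending t) × orient t ≡ t) ⊎ (¬ T (ascending t) × orient t ≡ rev t)
  orient-cases t with ascending t
  ... | true = inj₁ (_ , refl)
  ... | false = inj₂ ((λ ()) , refl)

  orient-of : ∀ t → orient t ≡ t ⊎ orient t ≡ rev t
  orient-of t with orient-cases t
  ... | inj₁ (_ , e) = inj₁ e
  ... | inj₂ (_ , e) = inj₂ e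

  Path2⇒Arc2 : ∀ {t} → T (isP2 Γ t) → Arc2 Γ t
  Path2⇒Arc2 {a , b , c} p with ∧-split (adj a b) p
  ... | ab , q with ∧-split (adj b c) q
  ... | bc , a<c = ab , bc , λ e → <-irrefl (cong toℕ e) (<ᵇ⇒< _ _ a<c)

  Path2⇒ascending : ∀ {t} → T (isP2 Γ t) → T (ascending t)
  Path2⇒ascending {a , b , c} p = proj₂ (∧-split (adj b c) (proj₂ (∧-split (adj a b) p)))

  Arc2⇒Path2 : ∀ {t} → Arc2 Γ t → T (ascending t) → T (isP2 Γ t)
  Arc2⇒Path2 (ab , bc , _) a<c = ∧-pair ab (∧-pair bc a<c)

  ascending-rev : ∀ {t} → Arc2 Γ t → ¬ T (ascending t) → T (ascending (rev t))
  ascending-rev (_ , _ , a≢c) ¬a<c = <⇒<ᵇ (≤∧≢⇒< (≮⇒≥ (¬a<c ∘ <⇒<ᵇ))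
                                                  (λ e → a≢c (FP.toℕ-injective (sym e))))

  ascending-antisym : ∀ {t} → T (ascending t) → ¬ T (ascending (rev t))
  ascending-antisym {a , _ , c} p q = <-asym (<ᵇ⇒< (toℕ a) (toℕ c) p) (<ᵇ⇒< (toℕ c) (toℕ a) q)

  orient-Path2 : ∀ {t} → Arc2 Γ t → T (isP2 Γ (orient t))
  orient-Path2 {t} p with orient-cases t
  ... | inj₁ (asc , e) = subst (T ∘ isP2 Γ) (sym e) (Arc2⇒Path2 p asc)
  ... | inj₂ (¬asc , e) = subst (T ∘ isP2 Γ) (sym e) (Arc2⇒Path2 (Arc2-rev p) (ascending-rev p ¬asc))

  orient-id : ∀ {t} → T (isP2 Γ t) → orient t ≡ t
  orient-id {t} p with orient-cases t
  ... | inj₁ (_ , e) = e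
  ... | inj₂ (¬asc , _) = ⊥-elim (¬asc (Path2⇒ascending p))

  orient-rev : ∀ {t} → Arc2 Γ t → orient (rev t) ≡ orient t
  orient-rev {t} p with orient-cases t | orient-cases (rev t)
  ... | inj₁ (asc , _) | inj₁ (asc′ , _) = ⊥-elim (ascending-antisym {t} asc asc′)
  ... | inj₁ (_ , e) | inj₂ (_ , e′) = trans e′ (sym e)
  ... | inj₂ (_ , e) | inj₁ (_ , e′) = trans e′ (sym e)
  ... | inj₂ (¬asc , _) | inj₂ (¬asc′ , _) = ⊥-elim (¬asc′ (ascending-rev p ¬asc))

  orient-injective : ∀ {u w} → orient u ≡ orient w → u ≡ w ⊎ u ≡ rev w
  orient-injective {u} {w} e with orient-of u | orient-of w
  ... | inj₁ eu | inj₁ ew = inj₁ (trans (sym eu) (trans e ew))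
  ... | inj₁ eu | inj₂ ew = inj₂ (trans (sym eu) (trans e ew))
  ... | inj₂ eu | inj₁ ew = inj₂ (cong rev (trans (sym eu) (trans e ew)))
  ... | inj₂ eu | inj₂ ew = inj₁ (cong rev (trans (sym eu) (trans e ew)))

  orient-SamePath : ∀ {t u} → T (isP2 Γ t) → SamePath Γ t u → t ≡ orient u
  orient-SamePath p (inj₁ refl) = sym (orient-id p)
  orient-SamePath p (inj₂ refl) = trans (sym (orient-id p)) (orient-rev (Arc2-rev (Path2⇒Arc2 p)))

  SamePath-orient : ∀ {u w} → orient u ≡ w → SamePath Γ w u
  SamePath-orient refl = orient-of _

  middle : Triple N → Fin N
  middle t = proj₁ (proj₂ t)

  orient-middle : ∀ t → middle (orient t) ≡ middle t
  orient-middle t with orient-of t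
  ... | inj₁ e = cong middle e
  ... | inj₂ e = cong middle e

  -- Counting edges: every edge {u,w} with u < w yields the two arcs
  -- (u,w) and (w,u), so twice the number of edges is the degree sum.

  Arcs : Set
  Arcs = Σ (Fin N) λ u → Σ (Fin N) λ w → T (adj u w)

  Edges : Set
  Edges = Σ (Fin N) λ u → Σ (Fin N) λ w → T (adj u w ∧ before u w)

  Arcs-↔ : Arcs ↔ Fin (sumF (degree Γ))
  Arcs-↔ = Σ-Fin-↔ _ (degree Γ) (countB-↔ ∘ adj)

  Edges-↔ : Edges ↔ Fin (numEdges Γ)
  Edges-↔ = Σ-Fin-↔ _ _ (λ u → countB-↔ (λ w → adj u w ∧ before u w))

  Arcs-↔-Edges⊎Edges : Arcs ↔ (Edges ⊎ Edges)
  Arcs-↔-Edges⊎Edges = mk↔ₛ′ split join split-join join-split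
    where
    split′ : ∀ u w → T (adj u w) → Dec (toℕ u < toℕ w) → Edges ⊎ Edges
    split′ u w p (yes u<w) = inj₁ (u , w , ∧-pair p (<⇒<ᵇ u<w))
    split′ u w p (no u≮w) = inj₂ (w , u , ∧-pair (Adj-sym p)
      (<⇒<ᵇ (≤∧≢⇒< (≮⇒≥ u≮w) (λ e → Adj⇒≢ p (FP.toℕ-injective (sym e))))))
    split : Arcs → Edges ⊎ Edges
    split (u , w , p) = split′ u w p (toℕ u <? toℕ w)
    join : Edges ⊎ Edges → Arcs
    join (inj₁ (u , w , p)) = u , w , proj₁ (∧-split (adj u w) p)
    join (inj₂ (u , w , p)) = w , u , Adj-sym (proj₁ (∧-split (adj u w) p))
    join-split′ : ∀ u w p d → join (split′ u w p d) ≡ (u , w , p)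
    join-split′ u w p (yes _) = cong (λ q → u , w , q) (T-irrelevant _ _)
    join-split′ u w p (no _) = cong (λ q → u , w , q) (T-irrelevant _ _)
    join-split : ∀ a → join (split a) ≡ a
    join-split (u , w , p) = join-split′ u w p _
    split-join : ∀ e → split (join e) ≡ e
    split-join (inj₁ (u , w , p)) with toℕ u <? toℕ w
    ... | yes _ = cong (λ q → inj₁ (u , w , q)) (T-irrelevant _ _)
    ... | no u≮w = ⊥-elim (u≮w (<ᵇ⇒< _ _ (proj₂ (∧-split (adj u w) p))))
    split-join (inj₂ (u , w , p)) with toℕ w <? toℕ u
    ... | yes w<u = ⊥-elim (<-asym w<u (<ᵇ⇒< _ _ (proj₂ (∧-split (adj u w) p))))
    ... | no _ = cong (λ q → inj₂ (u , w , q)) (T-irrelevant _ _)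

  twice-numEdges : numEdges Γ + numEdges Γ ≡ sumF (degree Γ)
  twice-numEdges = ↔⇒≡ (↔-trans FP.+↔⊎ (↔-trans (↔-sym (Edges-↔ ⊎-↔ Edges-↔))
                                 (↔-trans (↔-sym Arcs-↔-Edges⊎Edges) Arcs-↔)))

  twice-numEdges-regular : ∀ {v} → Regular Γ v → numEdges Γ + numEdges Γ ≡ N * v
  twice-numEdges-regular {v} reg = trans twice-numEdges (trans (sumF-cong reg) (sumF-const N v))

  -- Counting 2-paths by their middle vertex: the 2-paths through b
  -- correspond to the unordered pairs of neighbours of b.

  PathsThrough : Fin N → Set
  PathsThrough b = Σ (Fin N) λ a → Σ (Fin N) λ c → T (adj b a ∧ (adj b c ∧ before a c))

  PathsThrough-↔ : ∀ b → PathsThrough b ↔ Fin (pairs (adj b))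
  PathsThrough-↔ b = Σ-Fin-↔ _ _ (λ a → countB-↔ (λ c → adj b a ∧ (adj b c ∧ before a c)))

  path-through : ∀ {b} → PathsThrough b → Path2 Γ
  path-through {b} (a , c , p) = (a , b , c) , subst (λ z → T (z ∧ (adj b c ∧ before a c))) (adj-sym b a) p

  path-through-injective : ∀ {b} {q q′ : PathsThrough b} → proj₁ (path-through q) ≡ proj₁ (path-through q′) → q ≡ q′
  path-through-injective {q = a , c , p} {a′ , c′ , p′} e with cong proj₁ e | cong (proj₂ ∘ proj₂) e
  ... | refl | refl = cong (λ r → a , c , r) (T-irrelevant p p′)

  Path2-↔-middle : Path2 Γ ↔ Σ (Fin N) PathsThrough
  Path2-↔-middle = mk↔ₛ′ to (λ (b , q) → path-through q) to-from (λ P → Σ-T-≡ refl)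
    where
    to : Path2 Γ → Σ (Fin N) PathsThrough
    to ((a , b , c) , p) = b , a , c , subst (λ z → T (z ∧ (adj b c ∧ before a c))) (adj-sym a b) p
    to-from : ∀ q → to (path-through (proj₂ q)) ≡ q
    to-from (b , a , c , p) = cong (λ r → b , a , c , r) (T-irrelevant _ _)

  Path2-↔ : Path2 Γ ↔ Fin (sumF (λ b → pairs (adj b)))
  Path2-↔ = ↔-trans Path2-↔-middle (Σ-Fin-↔ _ _ PathsThrough-↔)

  pairs-regular : ∀ {v} → Regular Γ v → ∀ b → pairs (adj b) ≡ (v * (v ∸ 1)) / 2
  pairs-regular {v} reg b = trans (sym (m*n/n≡m (pairs (adj b)) 2))
    (cong (_/ 2) (trans (*-comm (pairs (adj b)) 2)
                        (trans (pairs-count (adj b)) (cong (λ k → k * (k ∸ 1)) (reg b)))))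

  Path2-count : ∀ {v} → Regular Γ v → Path2 Γ ↔ Fin (N * ((v * (v ∸ 1)) / 2))
  Path2-count {v} reg = subst (λ k → Path2 Γ ↔ Fin k)
    (trans (sumF-cong (pairs-regular reg)) (sumF-const N _)) Path2-↔

  HasCycle? : ∀ k → Dec (HasCycle Γ k)
  HasCycle? k = (3 ≤? k) ×-dec dec-∃-function k IsCycle respects IsCycle?
    where
    IsCycle : (Fin k → Fin N) → Set
    IsCycle c = (∀ i j → c i ≡ c j → i ≡ j) × (∀ i → Adj Γ (c i) (c (nextF i)))
    respects : ∀ f g → (∀ i → f i ≡ g i) → IsCycle f → IsCycle g
    respects f g e (inj , adjacent) =
      (λ i j q → inj i j (trans (e i) (trans q (sym (e j))))) ,
      (λ i → subst₂ (Adj Γ) (e i) (e (nextF i)) (adjacent i))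
    IsCycle? : ∀ f → Dec (IsCycle f)
    IsCycle? f = FP.all? (λ i → FP.all? (λ j → (f i F.≟ f j) →-dec (i F.≟ j)))
                 ×-dec FP.all? (λ i → T? (adj (f i) (f (nextF i))))

  girth-exists : ∀ {k} → HasCycle Γ k → Σ ℕ λ g → IsGirth Γ g × g ≤ k
  girth-exists {k} cyc with least (HasCycle Γ) HasCycle? k cyc
  ... | g , cyc-g , g≤k , shorter = g , (cyc-g , shorter) , g≤k

  complete-iso : ∀ {K} → N ≡ K → (∀ u w → Adj Γ u w ⇔ u ≢ w) →
    GraphIso (Fin N) (Fin K) (Adj Γ) KAdj
  complete-iso refl adj⇔≢ = (λ u → u) , ((λ e → e) , (λ y → y , λ e → e)) , adj⇔≢

  complete-regular : ∀ {v} → Regular Γ v → Fin N → (∀ u w → u ≢ w → Adj Γ u w) →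
    GraphIso (Fin N) (Fin (suc v)) (Adj Γ) KAdj
  complete-regular {v} reg τ complete =
    complete-iso N≡1+v (λ u w → mk⇔ Adj⇒≢ (complete u w))
    where
    same : Fin N → Bool
    same w = ⌊ τ F.≟ w ⌋
    adj≡not-same : ∀ w → adj τ w ≡ not (same w)
    adj≡not-same w with τ F.≟ w
    ... | yes refl = adj-irr τ
    ... | no τ≢w = Equivalence.to T-≡ (complete τ w τ≢w)
    N≡1+v : N ≡ suc v
    N≡1+v = begin
      N                                ≡⟨ sym (countB-complement same) ⟩
      countB same + countB (not ∘ same) ≡⟨ cong₂ _+_ (countB-singleton τ same (λ w p → sym (toWitness p)) (fromWitness refl))
                                                     (sym (countB-cong adj≡not-same)) ⟩
      1 + countB (adj τ)               ≡⟨ cong suc (reg τ) ⟩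
      suc v                            ∎
      where open ≡-Reasoning

module ActionFacts {c ℓ} {X : Group c ℓ} {N : ℕ} {Γ : Graph N} (A : Action X Γ) where
  open Group X using (_∙_; ε; _⁻¹; inverseˡ; inverseʳ)
  open Action A
  open GraphFacts Γ

  act-inv : ∀ g u → act (g ⁻¹) (act g u) ≡ u
  act-inv g u = trans (sym (act-∙ (g ⁻¹) g u)) (trans (act-≈ (inverseˡ g) u) (act-ε u))

  act-inv′ : ∀ g u → act g (act (g ⁻¹) u) ≡ u
  act-inv′ g u = trans (sym (act-∙ g (g ⁻¹) u)) (trans (act-≈ (inverseʳ g) u) (act-ε u))

  act-injective : ∀ g {u w} → act g u ≡ act g w → u ≡ w
  act-injective g {u} {w} e = trans (sym (act-inv g u)) (trans (cong (act (g ⁻¹)) e) (act-inv g w))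

  act-≢ : ∀ g {u w} → u ≢ w → act g u ≢ act g w
  act-≢ g u≢w = u≢w ∘ act-injective g

  act3-injective : ∀ g {s t} → act3 A g s ≡ act3 A g t → s ≡ t
  act3-injective g e = cong₂ _,_ (act-injective g (cong proj₁ e))
    (cong₂ _,_ (act-injective g (cong (proj₁ ∘ proj₂) e)) (act-injective g (cong (proj₂ ∘ proj₂) e)))

  Arc2-act : ∀ g {t} → Arc2 Γ t → Arc2 Γ (act3 A g t)
  Arc2-act g (p , q , a≢c) = act-adj g _ _ p , act-adj g _ _ q , act-≢ g a≢c

  Arc3-act : ∀ g {α} → Arc3 Γ α → Arc3 Γ (act4 A g α)
  Arc3-act g (p , q , r , a≢c , b≢d) =
    act-adj g _ _ p , act-adj g _ _ q , act-adj g _ _ r , act-≢ g a≢c , act-≢ g b≢d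

  act4-∙ : ∀ g h α → act4 A (g ∙ h) α ≡ act4 A g (act4 A h α)
  act4-∙ g h (a , b , c , d) =
    cong₂ _,_ (act-∙ g h a) (cong₂ _,_ (act-∙ g h b) (cong₂ _,_ (act-∙ g h c) (act-∙ g h d)))

  act4-ε : ∀ α → act4 A ε α ≡ α
  act4-ε (a , b , c , d) = cong₂ _,_ (act-ε a) (cong₂ _,_ (act-ε b) (cong₂ _,_ (act-ε c) (act-ε d)))

  -- In a 2-arc-transitive graph containing a triangle every 2-arc closes
  -- to a triangle, so any two vertices joined by a walk are equal or adjacent.
  triangle-reach : TwoArcTransitive A → HasCycle Γ 3 → ∀ {a b} → Reach Γ a b → a ≡ b ⊎ Adj Γ a b
  triangle-reach tat (_ , c , inj , adjacent) = within1
    where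
    triangle : Arc2 Γ (c zero , c (suc zero) , c (suc (suc zero)))
    triangle = adjacent zero , adjacent (suc zero) , λ e → 0≢2 (inj zero (suc (suc zero)) e)
      where
      0≢2 : _≡_ {A = Fin 3} zero (suc (suc zero)) → ⊥
      0≢2 ()
    close : ∀ {a b d} → Arc2 Γ (a , b , d) → Adj Γ a d
    close p with tat _ _ triangle p
    ... | g , e = subst₂ (Adj Γ) (cong proj₁ e) (cong (λ t → proj₂ (proj₂ t)) e)
                         (act-adj g _ _ (Adj-sym (adjacent (suc (suc zero)))))
    within1 : ∀ {a b} → Reach Γ a b → a ≡ b ⊎ Adj Γ a b
    within1 here = inj₁ refl
    within1 {a} {b} (step ab rest) with within1 rest
    ... | inj₁ refl = inj₂ ab
    ... | inj₂ a′b with a F.≟ b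
    ...   | yes a≡b = inj₁ a≡b
    ...   | no a≢b = inj₂ (close (ab , a′b , a≢b))

  triangle-complete : Connected Γ → TwoArcTransitive A → HasCycle Γ 3 →
    ∀ u w → u ≢ w → Adj Γ u w
  triangle-complete conn tat cyc u w u≢w with triangle-reach tat cyc (conn u w)
  ... | inj₁ u≡w = ⊥-elim (u≢w u≡w)
  ... | inj₂ uw = uw

record Setting c ℓ : Set (lsuc (c ⊔ ℓ)) where
  field
    X : Group c ℓ
    N : ℕ
    Γ : Graph N
    A : Action X Γ
    Δ : Quad N → Set
    two-arc-transitive : TwoArcTransitive A
    orbit : IsArc3Orbit A Δ
    self-paired : SelfPaired A Δ
    ell₁ : Ell1IsOne A Δ

-- By ℓ₁(Δ) = 1 every 2-arc (a,b,c) extends to a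
-- unique (a,b,c,d) ∈ Δ; then next (a,b,c) = (b,c,d).  The map next is
-- X-equivariant, and self-pairedness makes reversal conjugate it to its
-- inverse, so it is injective.
module Successor {c ℓ} (S : Setting c ℓ) where
  open Setting S
  open Group X using (Carrier; _∙_; ε; _⁻¹)
  open Action A
  open GraphFacts Γ
  open ActionFacts A

  extend : Triple N → Fin N → Quad N
  extend t d = proj₁ t , proj₁ (proj₂ t) , proj₂ (proj₂ t) , d

  δ : Quad N
  δ = proj₁ orbit

  δ-arc : Triple N
  δ-arc = proj₁ δ , proj₁ (proj₂ δ) , proj₁ (proj₂ (proj₂ δ))

  δ-last : Fin N
  δ-last = proj₂ (proj₂ (proj₂ δ))

  δ-Arc2 : Arc2 Γ δ-arc
  δ-Arc2 = let (p , q , _ , a≢c , _) = proj₁ (proj₂ orbit) in p , q , a≢c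

  Δ-orbit : ∀ α → Δ α ⇔ (∃[ g ] α ≡ act4 A g δ)
  Δ-orbit = proj₂ (proj₂ orbit)

  Δ-Arc3 : ∀ {α} → Δ α → Arc3 Γ α
  Δ-Arc3 {α} d with Equivalence.to (Δ-orbit α) d
  ... | g , refl = Arc3-act g (proj₁ (proj₂ orbit))

  Δ-act : ∀ g {α} → Δ α → Δ (act4 A g α)
  Δ-act g {α} d with Equivalence.to (Δ-orbit α) d
  ... | h , refl = Equivalence.from (Δ-orbit _) (g ∙ h , sym (act4-∙ g h δ))

  Δ-δ : Δ δ
  Δ-δ = Equivalence.from (Δ-orbit δ) (ε , sym (act4-ε δ))

  extension-unique : ∀ {a b c d d′} → Δ (a , b , c , d) → Δ (a , b , c , d′) → d ≡ d′
  extension-unique {d = d} {d′} p q with Equivalence.to (Δ-orbit _) p | Equivalence.to (Δ-orbit _) q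
  ... | g , eg | h , eh = begin
      d                          ≡⟨ cong (λ α → proj₂ (proj₂ (proj₂ α))) eg ⟩
      act g δ-last               ≡⟨ cong (act g) (sym (k-fixes-last)) ⟩
      act g (act k δ-last)       ≡⟨ cong (act g) (act-∙ (g ⁻¹) h δ-last) ⟩
      act g (act (g ⁻¹) (act h δ-last)) ≡⟨ act-inv′ g _ ⟩
      act h δ-last               ≡⟨ sym (cong (λ α → proj₂ (proj₂ (proj₂ α))) eh) ⟩
      d′                         ∎
    where
    open ≡-Reasoning
    k : Carrier
    k = g ⁻¹ ∙ h
    -- k = g⁻¹h fixes every vertex on which g and h agree
    fixes : ∀ {x y} → x ≡ act g y → x ≡ act h y → act k y ≡ y
    fixes {y = y} e₁ e₂ = trans (act-∙ (g ⁻¹) h y) (trans (cong (act (g ⁻¹)) (trans (sym e₂) e₁)) (act-inv g y))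
    k-fixes-last : act k δ-last ≡ δ-last
    k-fixes-last = ell₁ _ _ _ _ Δ-δ k (fixes (cong proj₁ eg) (cong proj₁ eh))
      (fixes (cong (proj₁ ∘ proj₂) eg) (cong (proj₁ ∘ proj₂) eh))
      (fixes (cong (proj₁ ∘ proj₂ ∘ proj₂) eg) (cong (proj₁ ∘ proj₂ ∘ proj₂) eh))

  -- the extension of a 2-arc t in Δ exists by 2-arc-transitivity
  abstract
    nextVertex : Triple N → Fin N
    nextVertex t with Arc2? t
    ... | yes p = act (proj₁ (two-arc-transitive δ-arc t δ-Arc2 p)) δ-last
    ... | no _ = proj₁ t

    Δ-extend : ∀ {t} → Arc2 Γ t → Δ (extend t (nextVertex t))
    Δ-extend {t} p with Arc2? t
    ... | no ¬p = ⊥-elim (¬p p)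
    ... | yes p′ with two-arc-transitive δ-arc t δ-Arc2 p′
    ... | g , e = subst (λ s → Δ (extend s (act g δ-last))) e (Δ-act g Δ-δ)

  Δ-nextVertex : ∀ {t d} → Δ (extend t d) → d ≡ nextVertex t
  Δ-nextVertex p = let (ab , bc , _ , a≢c , _) = Δ-Arc3 p in extension-unique p (Δ-extend (ab , bc , a≢c))

  next : Triple N → Triple N
  next t = proj₁ (proj₂ t) , proj₂ (proj₂ t) , nextVertex t

  next-Arc2 : ∀ {t} → Arc2 Γ t → Arc2 Γ (next t)
  next-Arc2 p = let (_ , q , r , _ , b≢d) = Δ-Arc3 (Δ-extend p) in q , r , b≢d

  nextVertex-equivariant : ∀ g {t} → Arc2 Γ t → nextVertex (act3 A g t) ≡ act g (nextVertex t)
  nextVertex-equivariant g p = sym (Δ-nextVertex (Δ-act g (Δ-extend p)))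

  next-equivariant : ∀ g {t} → Arc2 Γ t → next (act3 A g t) ≡ act3 A g (next t)
  next-equivariant g p = cong (λ z → _ , _ , z) (nextVertex-equivariant g p)

  -- self-pairedness: stepping back along a Δ-walk is stepping forward on the reverse
  next-rev-next : ∀ {t} → Arc2 Γ t → next (rev (next t)) ≡ rev t
  next-rev-next p = cong (λ z → _ , _ , z) (sym (Δ-nextVertex (self-paired _ _ _ _ (Δ-extend p))))

  next-injective : ∀ {s t} → Arc2 Γ s → Arc2 Γ t → next s ≡ next t → s ≡ t
  next-injective p q e =
    cong rev (trans (sym (next-rev-next p)) (trans (cong (next ∘ rev) e) (next-rev-next q)))

  walk : Triple N → ℕ → Triple N
  walk t zero = t
  walk t (suc k) = next (walk t k)

  vert : Triple N → ℕ → Fin N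
  vert t k = proj₁ (walk t k)

  walk-Arc2 : ∀ {t} → Arc2 Γ t → ∀ k → Arc2 Γ (walk t k)
  walk-Arc2 p zero = p
  walk-Arc2 p (suc k) = next-Arc2 (walk-Arc2 p k)

  walk-+ : ∀ t k j → walk t (k + j) ≡ walk (walk t j) k
  walk-+ t zero j = refl
  walk-+ t (suc k) j = cong next (walk-+ t k j)

  walk-suc : ∀ t j → walk t (suc j) ≡ walk (next t) j
  walk-suc t j = trans (cong (walk t) (+-comm 1 j)) (walk-+ t j 1)

  walk-equivariant : ∀ g {t} → Arc2 Γ t → ∀ k → walk (act3 A g t) k ≡ act3 A g (walk t k)
  walk-equivariant g p zero = refl
  walk-equivariant g p (suc k) =
    trans (cong next (walk-equivariant g p k)) (next-equivariant g (walk-Arc2 p k))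

  vert-equivariant : ∀ g {t} → Arc2 Γ t → ∀ k → vert (act3 A g t) k ≡ act g (vert t k)
  vert-equivariant g p k = cong proj₁ (walk-equivariant g p k)

  vert-adj : ∀ {t} → Arc2 Γ t → ∀ k → Adj Γ (vert t k) (vert t (suc k))
  vert-adj p k = proj₁ (walk-Arc2 p k)

  vert-≢₂ : ∀ {t} → Arc2 Γ t → ∀ k → vert t k ≢ vert t (suc (suc k))
  vert-≢₂ p k = proj₂ (proj₂ (walk-Arc2 p k))

  walk-by-vert : ∀ {t a b} → vert t a ≡ vert t b → vert t (suc a) ≡ vert t (suc b) →
    vert t (suc (suc a)) ≡ vert t (suc (suc b)) → walk t a ≡ walk t b
  walk-by-vert e₀ e₁ e₂ = cong₂ _,_ e₀ (cong₂ _,_ e₁ e₂)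

  -- by injectivity of next, a walk returning to an earlier 2-arc is periodic from its start
  walk-cancel : ∀ {t} → Arc2 Γ t → ∀ i p → walk t i ≡ walk t (i + p) → t ≡ walk t p
  walk-cancel q zero p e = e
  walk-cancel q (suc i) p e = walk-cancel q i p (next-injective (walk-Arc2 q i) (walk-Arc2 q (i + p)) e)

  walk-rev : ∀ {s} → Arc2 Γ s → ∀ j i → walk (rev (walk s (j + i))) j ≡ rev (walk s i)
  walk-rev p zero i = refl
  walk-rev {s} p (suc j) i = trans (walk-suc (rev (walk s (suc (j + i)))) j)
    (trans (cong (λ z → walk z j) (next-rev-next (walk-Arc2 p (j + i)))) (walk-rev p j i))

-- The walk from δ-arc returns to its
-- start (pigeonhole on the finitely many 2-arcs, plus injectivity of next);
-- 2-arc-transitivity carries its least period to every 2-arc.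
module Period {c ℓ} (S : Setting c ℓ) where
  open Setting S
  open Group X using (Carrier)
  open Action A
  open FiniteCounting
  open GraphFacts Γ
  open ActionFacts A
  open Successor S

  private
    returns : Σ ℕ λ p → 1 ≤ p × walk δ-arc p ≡ δ-arc
    returns with FP.pigeonhole (n<1+n _) (Inverse.to (Triple-↔ N) ∘ walk δ-arc ∘ toℕ)
    ... | i , j , i<j , e = toℕ j ∸ toℕ i , m<n⇒0<n∸m i<j ,
          sym (walk-cancel δ-Arc2 (toℕ i) (toℕ j ∸ toℕ i)
                (trans (↔-injective (Triple-↔ N) e) (cong (walk δ-arc) (sym (m+[n∸m]≡n (<⇒≤ i<j))))))

    IsPeriod : ℕ → Set
    IsPeriod k = 1 ≤ k × walk δ-arc k ≡ δ-arc

    leastPeriod : Σ ℕ λ g → IsPeriod g × g ≤ proj₁ returns × (∀ k → k < g → ¬ IsPeriod k)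
    leastPeriod = least IsPeriod (λ k → (1 ≤? k) ×-dec (walk δ-arc k ≟₃ δ-arc))
                        (proj₁ returns) (proj₂ returns)

  abstract
    n : ℕ
    n = proj₁ leastPeriod

    1≤n : 1 ≤ n
    1≤n = proj₁ (proj₁ (proj₂ leastPeriod))

    δ-period : walk δ-arc n ≡ δ-arc
    δ-period = proj₂ (proj₁ (proj₂ leastPeriod))

    δ-minimal : ∀ k → 1 ≤ k → k < n → walk δ-arc k ≢ δ-arc
    δ-minimal k 1≤k k<n e = proj₂ (proj₂ (proj₂ leastPeriod)) k k<n (1≤k , e)

  instance
    n≢0 : NonZero n
    n≢0 = >-nonZero 1≤n

  open Congruence n public hiding (1≤n)

  period : ∀ {t} → Arc2 Γ t → walk t n ≡ t
  period {t} p with two-arc-transitive δ-arc t δ-Arc2 p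
  ... | h , refl = trans (walk-equivariant h δ-Arc2 n) (cong (act3 A h) δ-period)

  minimal : ∀ {t} → Arc2 Γ t → ∀ k → 1 ≤ k → k < n → walk t k ≢ t
  minimal {t} p k 1≤k k<n e with two-arc-transitive δ-arc t δ-Arc2 p
  ... | h , refl = δ-minimal k 1≤k k<n (act3-injective h (trans (sym (walk-equivariant h δ-Arc2 k)) e))

  walk-+n : ∀ {t} → Arc2 Γ t → ∀ k → walk t (k + n) ≡ walk t k
  walk-+n {t} p k = trans (walk-+ t k n) (cong (λ z → walk z k) (period p))

  walk-+kn : ∀ {t} → Arc2 Γ t → ∀ k m → walk t (k + m * n) ≡ walk t k
  walk-+kn p k zero = cong (walk _) (+-identityʳ k)
  walk-+kn {t} p k (suc m) = trans (cong (walk t) reassoc) (trans (walk-+n p (k + m * n)) (walk-+kn p k m))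
    where
    reassoc : k + (n + m * n) ≡ k + m * n + n
    reassoc = trans (cong (k +_) (+-comm n (m * n))) (sym (+-assoc k (m * n) n))

  walk-mod : ∀ {t} → Arc2 Γ t → ∀ k → walk t k ≡ walk t (k % n)
  walk-mod {t} p k = trans (cong (walk t) (m≡m%n+[m/n]*n k n)) (walk-+kn p (k % n) (k / n))

  walk-≋ : ∀ {s} → Arc2 Γ s → ∀ {a b} → a ≋ b → walk s a ≡ walk s b
  walk-≋ {s} p {a} {b} e = trans (walk-mod p a) (trans (cong (walk s) e) (sym (walk-mod p b)))

  vert-≋ : ∀ {t} → Arc2 Γ t → ∀ {a b} → a ≋ b → vert t a ≡ vert t b
  vert-≋ p e = cong proj₁ (walk-≋ p e)

  shift : ∀ {t} → Arc2 Γ t → Σ Carrier λ g → ∀ k → act g (vert t k) ≡ vert t (suc k)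
  shift {t} p with two-arc-transitive t (walk t 1) p (walk-Arc2 p 1)
  ... | g , e = g , λ k → begin
      act g (vert t k)          ≡⟨ sym (vert-equivariant g p k) ⟩
      vert (act3 A g t) k       ≡⟨ cong (λ z → vert z k) e ⟩
      vert (walk t 1) k         ≡⟨ cong proj₁ (sym (walk-+ t k 1)) ⟩
      vert t (k + 1)            ≡⟨ cong (vert t) (+-comm k 1) ⟩
      vert t (suc k)            ∎
    where open ≡-Reasoning

  -- the first n vertices of a Δ-walk are distinct: a repetition at i < j < n
  -- would, by the shift, make the walk return after j - i < n steps
  vert-distinct : ∀ {t} → Arc2 Γ t → ∀ i j → i < j → j < n → vert t i ≢ vert t j
  vert-distinct {t} p i j i<j j<n e =
    minimal p (j ∸ i) (m<n⇒0<n∸m i<j) (≤-<-trans (m∸n≤m j i) j<n) (sym returns-early)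
    where
    g : Carrier
    g = proj₁ (shift p)
    agree : ∀ l → vert t (l + i) ≡ vert t (l + j)
    agree zero = e
    agree (suc l) = begin
      vert t (suc (l + i))      ≡⟨ sym (proj₂ (shift p) (l + i)) ⟩
      act g (vert t (l + i))    ≡⟨ cong (act g) (agree l) ⟩
      act g (vert t (l + j))    ≡⟨ proj₂ (shift p) (l + j) ⟩
      vert t (suc (l + j))      ∎
      where open ≡-Reasoning
    agree-walk : ∀ l → walk t (l + i) ≡ walk t (l + j)
    agree-walk l = walk-by-vert {t} {l + i} {l + j} (agree l) (agree (suc l)) (agree (suc (suc l)))
    i≤n : i ≤ n
    i≤n = <⇒≤ (<-trans i<j j<n)
    returns-early : t ≡ walk t (j ∸ i)
    returns-early = begin
      t                                ≡⟨ sym (period p) ⟩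
      walk t n                         ≡⟨ cong (walk t) (sym (m∸n+n≡m i≤n)) ⟩
      walk t ((n ∸ i) + i)             ≡⟨ agree-walk (n ∸ i) ⟩
      walk t ((n ∸ i) + j)             ≡⟨ cong (λ k → walk t ((n ∸ i) + k)) (sym (m∸n+n≡m (<⇒≤ i<j))) ⟩
      walk t ((n ∸ i) + ((j ∸ i) + i)) ≡⟨ cong (walk t) (+-comm-middle (n ∸ i) (j ∸ i) i) ⟩
      walk t ((j ∸ i) + ((n ∸ i) + i)) ≡⟨ cong (λ k → walk t ((j ∸ i) + k)) (m∸n+n≡m i≤n) ⟩
      walk t ((j ∸ i) + n)             ≡⟨ walk-+n p (j ∸ i) ⟩
      walk t (j ∸ i)                   ∎
      where
      open ≡-Reasoning
      +-comm-middle : ∀ a b c → a + (b + c) ≡ b + (a + c)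
      +-comm-middle = solve-∀

  ≋-vert : ∀ {t} → Arc2 Γ t → ∀ {a b} → vert t a ≡ vert t b → a ≋ b
  ≋-vert {t} p {a} {b} e with <-cmp (a % n) (b % n)
  ... | tri≈ _ q _ = q
  ... | tri< q _ _ = ⊥-elim (vert-distinct p _ _ q (m%n<n b n)
                       (trans (vert-≋ p (≋-mod a)) (trans e (sym (vert-≋ p (≋-mod b))))))
  ... | tri> _ _ q = ⊥-elim (vert-distinct p _ _ q (m%n<n a n)
                       (trans (vert-≋ p (≋-mod b)) (trans (sym e) (sym (vert-≋ p (≋-mod a))))))

  -- n ≥ 3, as a 2-arc is neither a 1-cycle nor a 2-cycle
  3≤n : 3 ≤ n
  3≤n with 3 ≤? n
  ... | yes 3≤n = 3≤n
  ... | no 3≰n = ⊥-elim (small n 1≤n 3≰n refl)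
    where
    first-vertex : ∀ k → n ≡ k → vert δ-arc k ≡ vert δ-arc 0
    first-vertex k refl = cong proj₁ (period δ-Arc2)
    small : ∀ k → 1 ≤ k → ¬ 3 ≤ k → n ≢ k
    small 1 _ _ n≡1 = Adj⇒≢ (vert-adj δ-Arc2 0) (sym (first-vertex 1 n≡1))
    small 2 _ _ n≡2 = vert-≢₂ δ-Arc2 0 (sym (first-vertex 2 n≡2))
    small (suc (suc (suc k))) _ 3≰k _ = 3≰k (s≤s (s≤s (s≤s z≤n)))

module Cycles {c ℓ} (S : Setting c ℓ) where
  open Setting S
  open FiniteCounting
  open GraphFacts Γ
  open Successor S
  open Period S

  SameEdge : Fin N → Fin N → Fin N → Fin N → Set
  SameEdge u w a b = (u ≡ a × w ≡ b) ⊎ (w ≡ a × u ≡ b)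

  SameEdge-trans : ∀ {u w a b c d} → SameEdge u w a b → SameEdge a b c d → SameEdge u w c d
  SameEdge-trans (inj₁ (refl , refl)) e = e
  SameEdge-trans (inj₂ (refl , refl)) (inj₁ (refl , refl)) = inj₂ (refl , refl)
  SameEdge-trans (inj₂ (refl , refl)) (inj₂ (refl , refl)) = inj₁ (refl , refl)

  SameEdge-sym : ∀ {u w a b} → SameEdge u w a b → SameEdge w u a b
  SameEdge-sym (inj₁ e) = inj₂ e
  SameEdge-sym (inj₂ e) = inj₁ e

  SameEdge? : ∀ u w a b → Dec (SameEdge u w a b)
  SameEdge? u w a b = ((u F.≟ a) ×-dec (w F.≟ b)) ⊎-dec ((w F.≟ a) ×-dec (u F.≟ b))

  CycleEdge : Triple N → Fin N → Fin N → Set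
  CycleEdge t u w = ∃[ k ] SameEdge u w (vert t k) (vert t (suc k))

  CycleEdge-sym : ∀ {t u w} → CycleEdge t u w → CycleEdge t w u
  CycleEdge-sym (k , e) = k , SameEdge-sym e

  CycleEdge-vert : ∀ {t u w} → CycleEdge t u w → ∃[ p ] u ≡ vert t p
  CycleEdge-vert (k , inj₁ (e , _)) = k , e
  CycleEdge-vert (k , inj₂ (_ , e)) = suc k , e

  cycle-neighbours : ∀ {t} → Arc2 Γ t → ∀ q {w} → CycleEdge t (vert t q) w →
    w ≡ vert t (suc q) ⊎ w ≡ vert t (prev q)
  cycle-neighbours p q (k , inj₁ (e , f)) =
    inj₁ (trans f (vert-≋ p (≋-+ˡ 1 (≋-vert p {k} {q} (sym e)))))
  cycle-neighbours p q (k , inj₂ (e , f)) =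
    inj₂ (trans e (vert-≋ p (≋-cancel 1 (trans (≡⇒≋ (+-comm k 1))
      (trans (≋-vert p {suc k} {q} (sym f)) (trans (sym (suc-prev q)) (≡⇒≋ (+-comm 1 (prev q)))))))))

  around : ∀ {t} → Arc2 Γ t → ∀ q → (vert t (prev q) , vert t q , vert t (suc q)) ≡ walk t (prev q)
  around p q = cong₂ _,_ refl (cong₂ _,_ (sym (vert-≋ p (suc-prev q))) (sym (vert-≋ p (≋-+ˡ 1 (suc-prev q)))))

  cycle-segment : ∀ {t} → Arc2 Γ t → ∀ {a b d} → a ≢ d → CycleEdge t a b → CycleEdge t b d →
    ∃[ k ] ((a , b , d) ≡ walk t k ⊎ (d , b , a) ≡ walk t k)
  cycle-segment {t} p {a} {b} {d} a≢d ab bd with CycleEdge-vert bd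
  ... | q , refl with cycle-neighbours p q (CycleEdge-sym ab) | cycle-neighbours p q bd
  ... | inj₁ a≡ | inj₁ d≡ = ⊥-elim (a≢d (trans a≡ (sym d≡)))
  ... | inj₂ a≡ | inj₂ d≡ = ⊥-elim (a≢d (trans a≡ (sym d≡)))
  ... | inj₂ a≡ | inj₁ d≡ =
    prev q , inj₁ (subst₂ (λ x y → (x , vert t q , y) ≡ walk t (prev q)) (sym a≡) (sym d≡) (around p q))
  ... | inj₁ a≡ | inj₂ d≡ =
    prev q , inj₂ (subst₂ (λ x y → (x , vert t q , y) ≡ walk t (prev q)) (sym d≡) (sym a≡) (around p q))

  cycleVertex : Triple N → Fin n → Fin N
  cycleVertex t i = vert t (toℕ i)

  cycleVertex-next : ∀ {t} → Arc2 Γ t → ∀ i → cycleVertex t (nextF i) ≡ vert t (suc (toℕ i))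
  cycleVertex-next p i = vert-≋ p (trans (cong (_% n) (nextF-toℕ i)) (≋-mod _))

  cycleEdges : Triple N → EdgeSet N
  cycleEdges t u w = ⌊ FP.any? (λ i → SameEdge? u w (cycleVertex t i) (cycleVertex t (nextF i))) ⌋

  cycleEdges⇒CycleEdge : ∀ {t} → Arc2 Γ t → ∀ {u w} → T (cycleEdges t u w) → CycleEdge t u w
  cycleEdges⇒CycleEdge p e with toWitness e
  ... | i , same = toℕ i , SameEdge-trans same (inj₁ (refl , cycleVertex-next p i))

  CycleEdge⇒cycleEdges : ∀ {t} → Arc2 Γ t → ∀ {u w} → CycleEdge t u w → T (cycleEdges t u w)
  CycleEdge⇒cycleEdges {t} p (k , same) = fromWitness (k mod n , SameEdge-trans same (inj₁ (at-k , at-suc-k)))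
    where
    k≋ : toℕ (k mod n) ≋ k
    k≋ = trans (cong (_% n) (toℕ-mod k)) (≋-mod k)
    at-k : vert t k ≡ cycleVertex t (k mod n)
    at-k = vert-≋ p (sym k≋)
    at-suc-k : vert t (suc k) ≡ cycleVertex t (nextF (k mod n))
    at-suc-k = trans (vert-≋ p (≋-+ˡ 1 (sym k≋))) (sym (cycleVertex-next p (k mod n)))

  cycleEdges-walk : ∀ {t} → Arc2 Γ t → ∀ k → T (cycleEdges t (vert t k) (vert t (suc k)))
  cycleEdges-walk p k = CycleEdge⇒cycleEdges p (k , inj₁ (refl , refl))

  cycleEdges-IsNCycle : ∀ {t} → Arc2 Γ t → IsNCycle Γ n (cycleEdges t)
  cycleEdges-IsNCycle {t} p = 3≤n , cycleVertex t , injective ,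
    (λ i → subst (Adj Γ (cycleVertex t i)) (sym (cycleVertex-next p i)) (vert-adj p (toℕ i))) ,
    (λ u w → mk⇔ toWitness fromWitness)
    where
    injective : ∀ i j → cycleVertex t i ≡ cycleVertex t j → i ≡ j
    injective i j e = Fin-≋ i j (≋-vert p e)

  SameCycle : Triple N → Triple N → Set
  SameCycle s t = ∃[ K ] (t ≡ walk s K ⊎ t ≡ rev (walk s K))

  walk-rev-≋ : ∀ {s} → Arc2 Γ s → ∀ K j → Σ ℕ λ i → (i + j) ≋ K × walk (rev (walk s K)) j ≡ rev (walk s i)
  walk-rev-≋ {s} p K j = i , i+j≋K , retrace
    where
    j≤K+jn : j ≤ K + j * n
    j≤K+jn = ≤-trans (subst (_≤ j * n) (*-identityʳ j) (*-monoʳ-≤ j 1≤n)) (m≤n+m (j * n) K)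
    i : ℕ
    i = K + j * n ∸ j
    j+i : j + i ≡ K + j * n
    j+i = m+[n∸m]≡n j≤K+jn
    i+j≋K : (i + j) ≋ K
    i+j≋K = trans (≡⇒≋ (trans (+-comm i j) j+i)) (≋-kn K j)
    retrace : walk (rev (walk s K)) j ≡ rev (walk s i)
    retrace = trans (cong (λ z → walk (rev z) j) (trans (sym (walk-+kn p K j)) (cong (walk s) (sym j+i))))
                    (walk-rev p j i)

  SameCycle-Arc2 : ∀ {s t} → Arc2 Γ s → SameCycle s t → Arc2 Γ t
  SameCycle-Arc2 p (K , inj₁ refl) = walk-Arc2 p K
  SameCycle-Arc2 p (K , inj₂ refl) = Arc2-rev (walk-Arc2 p K)

  SameCycle-sym : ∀ {s t} → Arc2 Γ s → SameCycle s t → SameCycle t s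
  SameCycle-sym {s} p (K , inj₁ refl) = offset K 0 , inj₁ (sym (begin
      walk (walk s K) (offset K 0) ≡⟨ sym (walk-+ s (offset K 0) K) ⟩
      walk s (offset K 0 + K)      ≡⟨ walk-≋ p {offset K 0 + K} {0} (trans (≡⇒≋ (+-comm (offset K 0) K)) (offset-≋ K 0)) ⟩
      s                            ∎))
    where open ≡-Reasoning
  SameCycle-sym {s} p (K , inj₂ refl) with walk-rev-≋ p K K
  ... | i , i+K≋K , retrace = K , inj₂ (sym (trans (cong rev retrace) (walk-≋ p {i} {0} (≋-cancel K i+K≋K))))

  SameCycle-⊆ : ∀ {s t} → Arc2 Γ s → SameCycle s t → ∀ {u w} → CycleEdge t u w → CycleEdge s u w
  SameCycle-⊆ {s} p (K , inj₁ refl) (k , same) =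
    k + K , SameEdge-trans same (inj₁ (cong proj₁ e , cong (proj₁ ∘ proj₂) e))
    where
    e : walk (walk s K) k ≡ walk s (k + K)
    e = sym (walk-+ s k K)
  SameCycle-⊆ {s} p (K , inj₂ refl) (k , same) with walk-rev-≋ p K k
  ... | i , _ , e = suc i , SameEdge-trans same (inj₂ (cong (proj₁ ∘ proj₂) e , cong proj₁ e))

  cycleEdges-SameCycle : ∀ {s t} → Arc2 Γ s → SameCycle s t → ∀ u w → cycleEdges s u w ≡ cycleEdges t u w
  cycleEdges-SameCycle {s} {t} p same u w = T-extensional
    (CycleEdge⇒cycleEdges q ∘ SameCycle-⊆ q (SameCycle-sym p same) ∘ cycleEdges⇒CycleEdge p)
    (CycleEdge⇒cycleEdges p ∘ SameCycle-⊆ p same ∘ cycleEdges⇒CycleEdge q)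
    where
    q : Arc2 Γ t
    q = SameCycle-Arc2 p same

-- Each cycle is represented by
-- its canonical 2-path, the one of least code among the 2-paths on it; the
-- canonical 2-paths are enumerated as base 0, …, base (m-1), and the 2-path
-- at position j of cycle i is the orientation of walk (base i) j.
module Canonical {c ℓ} (S : Setting c ℓ) where
  open Setting S
  open FiniteCounting
  open GraphFacts Γ
  open Successor S
  open Period S
  open Cycles S

  OnCycle : Triple N → Triple N → Set
  OnCycle s P = ∃[ k ] orient (walk s k) ≡ P

  OnCycle-⊆ : ∀ {s t} → Arc2 Γ s → SameCycle s t → ∀ {P} → OnCycle t P → OnCycle s P
  OnCycle-⊆ {s} p (K , inj₁ refl) (k , refl) = k + K , cong orient (walk-+ s k K)
  OnCycle-⊆ {s} p (K , inj₂ refl) (k , refl) with walk-rev-≋ p K k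
  ... | i , _ , e = i , trans (sym (orient-rev (walk-Arc2 p i))) (cong orient (sym e))

  SameCycle-orient : ∀ t → SameCycle t (orient t)
  SameCycle-orient t = 0 , orient-of t

  abstract
    code : Triple N → ℕ
    code t = toℕ (Inverse.to (Triple-↔ N) t)

    code-injective : ∀ {s t} → code s ≡ code t → s ≡ t
    code-injective = ↔-injective (Triple-↔ N) ∘ FP.toℕ-injective

  OnCycle⇒SameCycle : ∀ {s P} → OnCycle s P → SameCycle s P
  OnCycle⇒SameCycle {s} (k , refl) = k , orient-of (walk s k)

  private
    least-code : (s : Triple N) → Σ ℕ λ i → i < n × (∀ j → j < n → code (orient (walk s i)) ≤ code (orient (walk s j)))
    least-code s = argmin-below n 1≤n (λ k → code (orient (walk s k)))

  abstract
    canonical : Triple N → Triple N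
    canonical s = orient (walk s (proj₁ (least-code s)))

    canonical-OnCycle : ∀ s → OnCycle s (canonical s)
    canonical-OnCycle s = proj₁ (least-code s) , refl

    canonical-least : ∀ {s} → Arc2 Γ s → ∀ {P} → OnCycle s P → code (canonical s) ≤ code P
    canonical-least {s} p (k , refl) = subst (λ z → code (canonical s) ≤ code (orient z)) (sym (walk-mod p k))
      (proj₂ (proj₂ (least-code s)) (k % n) (m%n<n k n))

  canonical-SameCycle : ∀ {s t} → Arc2 Γ s → SameCycle s t → canonical t ≡ canonical s
  canonical-SameCycle {s} {t} p same = code-injective (≤-antisym
    (canonical-least q (OnCycle-⊆ q (SameCycle-sym p same) (canonical-OnCycle s)))
    (canonical-least p (OnCycle-⊆ p same (canonical-OnCycle t))))
    where
    q : Arc2 Γ t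
    q = SameCycle-Arc2 p same

  OnCycle-canonical-≡ : ∀ {s P} → Arc2 Γ s → OnCycle s P → canonical P ≡ canonical s
  OnCycle-canonical-≡ p on = canonical-SameCycle p (OnCycle⇒SameCycle on)

  canonical-Path2 : ∀ {s} → Arc2 Γ s → T (isP2 Γ (canonical s))
  canonical-Path2 {s} p with canonical-OnCycle s
  ... | k , e = subst (T ∘ isP2 Γ) e (orient-Path2 (walk-Arc2 p k))

  canonical-Arc2 : ∀ {s} → Arc2 Γ s → Arc2 Γ (canonical s)
  canonical-Arc2 = Path2⇒Arc2 ∘ canonical-Path2

  canonical-idem : ∀ {s} → Arc2 Γ s → canonical (canonical s) ≡ canonical s
  canonical-idem {s} p = OnCycle-canonical-≡ p (canonical-OnCycle s)

  OnCycle-canonical : ∀ {P} → T (isP2 Γ P) → OnCycle (canonical P) P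
  OnCycle-canonical {P} p = OnCycle-⊆ (canonical-Arc2 q)
    (SameCycle-sym q (OnCycle⇒SameCycle (canonical-OnCycle P))) (0 , orient-id p)
    where
    q : Arc2 Γ P
    q = Path2⇒Arc2 p

  isCanonical : Triple N → Bool
  isCanonical t = isP2 Γ t ∧ ⌊ canonical t ≟₃ t ⌋

  abstract
    m : ℕ
    m = countB (isCanonical ∘ Inverse.from (Triple-↔ N))

    canonicals-↔ : Σ (Triple N) (T ∘ isCanonical) ↔ Fin m
    canonicals-↔ = count-↔ (Triple-↔ N) isCanonical

  base : Fin m → Triple N
  base i = proj₁ (Inverse.from canonicals-↔ i)

  base-isCanonical : ∀ i → T (isCanonical (base i))
  base-isCanonical i = proj₂ (Inverse.from canonicals-↔ i)

  base-Path2 : ∀ i → T (isP2 Γ (base i))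
  base-Path2 i = proj₁ (∧-split (isP2 Γ (base i)) (base-isCanonical i))

  base-Arc2 : ∀ i → Arc2 Γ (base i)
  base-Arc2 = Path2⇒Arc2 ∘ base-Path2

  base-canonical : ∀ i → canonical (base i) ≡ base i
  base-canonical i = toWitness (proj₂ (∧-split (isP2 Γ (base i)) (base-isCanonical i)))

  index : ∀ t → T (isCanonical t) → Fin m
  index t p = Inverse.to canonicals-↔ (t , p)

  base-index : ∀ t p → base (index t p) ≡ t
  base-index t p = cong proj₁ (Inverse.strictlyInverseʳ canonicals-↔ (t , p))

  index-base : ∀ i p → index (base i) p ≡ i
  index-base i p = trans (cong (index (base i)) (T-irrelevant _ _)) (Inverse.strictlyInverseˡ canonicals-↔ i)

  index-cong : ∀ {t t′} p p′ → t ≡ t′ → index t p ≡ index t′ p′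
  index-cong p p′ refl = cong (index _) (T-irrelevant p p′)

  canonical-isCanonical : ∀ {t} → Arc2 Γ t → T (isCanonical (canonical t))
  canonical-isCanonical p = ∧-pair (canonical-Path2 p) (fromWitness (canonical-idem p))

  cycleOf : (t : Triple N) → Arc2 Γ t → Fin m
  cycleOf t p = index (canonical t) (canonical-isCanonical p)

  base-cycleOf : ∀ t p → base (cycleOf t p) ≡ canonical t
  base-cycleOf t p = base-index _ _

  canonical-along-base : ∀ i k → canonical (orient (walk (base i) k)) ≡ base i
  canonical-along-base i k = trans (OnCycle-canonical-≡ (base-Arc2 i) (k , refl)) (base-canonical i)

  cycleOf-unique : ∀ t p i k → orient (walk (base i) k) ≡ orient t → cycleOf t p ≡ i
  cycleOf-unique t p i k e = trans (index-cong _ (base-isCanonical i) same-canonical) (index-base i _)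
    where
    same-canonical : canonical t ≡ base i
    same-canonical = begin
      canonical t                          ≡⟨ sym (canonical-SameCycle p (SameCycle-orient t)) ⟩
      canonical (orient t)                 ≡⟨ cong canonical (sym e) ⟩
      canonical (orient (walk (base i) k)) ≡⟨ canonical-along-base i k ⟩
      base i                               ∎
      where open ≡-Reasoning

module PathIndex {c ℓ} (S : Setting c ℓ) where
  open Setting S
  open FiniteCounting
  open GraphFacts Γ
  open Successor S
  open Period S
  open Canonical S

  abstract
    AtPosition : Triple N → Triple N → Fin n → Set
    AtPosition r P j = orient (walk r (toℕ j)) ≡ P

    search : ∀ {r P} → Dec (∃ (AtPosition r P)) → Fin n
    search (yes (j , _)) = j
    search (no _) = 0 mod n

    position : Triple N → Triple N → Fin n
    position r P = search (FP.any? (λ j → orient (walk r (toℕ j)) ≟₃ P))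

    search-spec : ∀ {r P} → Arc2 Γ r → OnCycle r P → (d : Dec (∃ (AtPosition r P))) →
      orient (walk r (toℕ (search d))) ≡ P
    search-spec p _ (yes (j , e)) = e
    search-spec {r} p (k , e) (no none) =
      ⊥-elim (none (k mod n , trans (cong (orient ∘ walk r) (toℕ-mod k)) (trans (cong orient (sym (walk-mod p k))) e)))

    position-spec : ∀ {r P} → Arc2 Γ r → OnCycle r P → orient (walk r (toℕ (position r P))) ≡ P
    position-spec {r} {P} p on = search-spec p on (FP.any? (λ j → orient (walk r (toℕ j)) ≟₃ P))

  position-unique : ∀ {r} → Arc2 Γ r → ∀ a b → orient (walk r a) ≡ orient (walk r b) → a ≋ b
  position-unique {r} p a b e with orient-injective {walk r a} {walk r b} e
  ... | inj₁ same = ≋-vert p (cong proj₁ same)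
  ... | inj₂ reversed = ⊥-elim (vert-≢₂ p a (trans (vert-≋ p a≋b) (sym (cong (proj₂ ∘ proj₂) reversed))))
    where
    -- the middle vertices agree, so the two 2-arcs sit at the same position;
    -- but a 2-arc of a walk is not its own reverse, as its ends differ
    a≋b : a ≋ b
    a≋b = ≋-cancel 1 (trans (≡⇒≋ (+-comm a 1)) (trans (≋-vert p {suc a} {suc b} (cong (proj₁ ∘ proj₂) reversed))
                                                        (≡⇒≋ (+-comm 1 b))))

  pathAt : Fin m × Fin n → Path2 Γ
  pathAt (i , j) = orient (walk (base i) (toℕ j)) , orient-Path2 (walk-Arc2 (base-Arc2 i) (toℕ j))

  locate : Path2 Γ → Fin m × Fin n
  locate (t , p) = cycleOf t (Path2⇒Arc2 p) , position (canonical t) t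

  pathAt-locate : ∀ P → pathAt (locate P) ≡ P
  pathAt-locate (t , p) = Σ-T-≡ (begin
      orient (walk (base (cycleOf t q)) (toℕ (position (canonical t) t)))
        ≡⟨ cong (λ r → orient (walk r (toℕ (position (canonical t) t)))) (base-cycleOf t q) ⟩
      orient (walk (canonical t) (toℕ (position (canonical t) t)))
        ≡⟨ position-spec (canonical-Arc2 q) (OnCycle-canonical p) ⟩
      t ∎)
    where
    open ≡-Reasoning
    q : Arc2 Γ t
    q = Path2⇒Arc2 p

  locate-pathAt : ∀ ij → locate (pathAt ij) ≡ ij
  locate-pathAt (i , j) = cong₂ _,_ (cycleOf-unique t q i (toℕ j) (sym (orient-id (proj₂ (pathAt (i , j))))))
                                    same-position
    where
    t : Triple N
    t = orient (walk (base i) (toℕ j))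
    q : Arc2 Γ t
    q = Path2⇒Arc2 (proj₂ (pathAt (i , j)))
    same-position : position (canonical t) t ≡ j
    same-position rewrite canonical-along-base i (toℕ j) =
      Fin-≋ _ j (position-unique (base-Arc2 i) _ (toℕ j) (position-spec (base-Arc2 i) (toℕ j , refl)))

  Path2-↔-cycles : Path2 Γ ↔ (Fin m × Fin n)
  Path2-↔-cycles = mk↔ₛ′ locate pathAt locate-pathAt pathAt-locate

  locate-at : ∀ P i k → orient (walk (base i) k) ≡ proj₁ P → locate P ≡ (i , k mod n)
  locate-at P i k e = trans (cong locate (sym at)) (locate-pathAt (i , k mod n))
    where
    at : pathAt (i , k mod n) ≡ P
    at = Σ-T-≡ (trans (cong (λ z → orient (walk (base i) z)) (toℕ-mod k))
                      (trans (cong orient (sym (walk-mod (base-Arc2 i) k))) e))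

  at-locate : ∀ P → orient (walk (base (proj₁ (locate P))) (toℕ (proj₂ (locate P)))) ≡ proj₁ P
  at-locate P = cong proj₁ (pathAt-locate P)

-- ℷ(Σ, Δ) ≅ m C_n: under locate, the Δ-step [a,b,c] ↦ [b,c,d] moves one
-- position along a cycle, and consecutive positions come from a Δ-step.
module GimelIso {c ℓ} (S : Setting c ℓ) where
  open Setting S
  open FiniteCounting
  open GraphFacts Γ
  open Successor S
  open Period S
  open Canonical S
  open PathIndex S

  consecutive : ∀ {s} → Arc2 Γ s → ∀ P Q → proj₁ P ≡ orient s → proj₁ Q ≡ orient (next s) →
    mCnAdj (locate P) (locate Q)
  consecutive {s} p P Q P≡ Q≡ = along (orient-injective (trans (at-locate P) P≡))
    where
    i : Fin m
    i = proj₁ (locate P)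
    j : Fin n
    j = proj₂ (locate P)
    along : walk (base i) (toℕ j) ≡ s ⊎ walk (base i) (toℕ j) ≡ rev s → mCnAdj (locate P) (locate Q)
    along (inj₁ forward) = sym (cong proj₁ Q-at) , inj₁ (trans (cong proj₂ Q-at) (sym (nextF-mod j)))
      where
      Q-at : locate Q ≡ (i , suc (toℕ j) mod n)
      Q-at = locate-at Q i (suc (toℕ j)) (trans (cong (orient ∘ next) forward) (sym Q≡))
    along (inj₂ backward) = sym (cong proj₁ Q-at) , inj₂ (trans (sym (nextF-prev j)) (cong nextF (sym (cong proj₂ Q-at))))
      where
      -- walking back from position j of cycle i retraces the reversed Δ-step
      back : walk (base i) (prev (toℕ j)) ≡ rev (next s)
      back = next-injective (walk-Arc2 (base-Arc2 i) (prev (toℕ j))) (Arc2-rev (next-Arc2 p))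
        (trans (walk-≋ (base-Arc2 i) {suc (prev (toℕ j))} {toℕ j} (suc-prev (toℕ j)))
               (trans backward (sym (next-rev-next p))))
      Q-at : locate Q ≡ (i , prev (toℕ j) mod n)
      Q-at = locate-at Q i (prev (toℕ j)) (trans (cong orient back) (trans (orient-rev (next-Arc2 p)) (sym Q≡)))

  mCnAdj-sym : ∀ {m n} {a b : Fin m × Fin n} → mCnAdj a b → mCnAdj b a
  mCnAdj-sym (e , inj₁ q) = sym e , inj₂ q
  mCnAdj-sym (e , inj₂ q) = sym e , inj₁ q

  Δ-consecutive : ∀ {a₀ a₁ a₂ a₃} → Δ (a₀ , a₁ , a₂ , a₃) → ∀ P Q →
    SamePath Γ (proj₁ P) (a₀ , a₁ , a₂) → SamePath Γ (proj₁ Q) (a₁ , a₂ , a₃) →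
    mCnAdj (locate P) (locate Q)
  Δ-consecutive d P Q P~ Q~ with Δ-Arc3 d | Δ-nextVertex d
  ... | (ab , bc , _ , a≢c , _) | refl =
    consecutive (ab , bc , a≢c) P Q (orient-SamePath (proj₂ P) P~) (orient-SamePath (proj₂ Q) Q~)

  gimel⇒mCn : ∀ P Q → GimelAdj Γ Δ P Q → mCnAdj (locate P) (locate Q)
  gimel⇒mCn P Q (_ , d , inj₁ (P~ , Q~)) = Δ-consecutive d P Q P~ Q~
  gimel⇒mCn P Q (_ , d , inj₂ (Q~ , P~)) = mCnAdj-sym (Δ-consecutive d Q P Q~ P~)

  consecutive-Δ : ∀ P Q → proj₁ (locate P) ≡ proj₁ (locate Q) → proj₂ (locate Q) ≡ nextF (proj₂ (locate P)) →
    ∃[ α ] (Δ α × SamePath Γ (proj₁ P) (proj₁ α , proj₁ (proj₂ α) , proj₁ (proj₂ (proj₂ α)))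
                × SamePath Γ (proj₁ Q) (proj₁ (proj₂ α) , proj₁ (proj₂ (proj₂ α)) , proj₂ (proj₂ (proj₂ α))))
  consecutive-Δ P Q same-cycle next-position =
    extend s (nextVertex s) , Δ-extend (walk-Arc2 (base-Arc2 i) j) ,
    SamePath-orient (at-locate P) , SamePath-orient Q-at
    where
    i : Fin m
    i = proj₁ (locate P)
    j : ℕ
    j = toℕ (proj₂ (locate P))
    s : Triple N
    s = walk (base i) j
    suc-j≋ : suc j ≋ toℕ (proj₂ (locate Q))
    suc-j≋ = sym (trans (cong (λ z → toℕ z % n) next-position)
                        (trans (cong (_% n) (nextF-toℕ (proj₂ (locate P)))) (≋-mod (suc j))))
    Q-at : orient (next s) ≡ proj₁ Q
    Q-at = trans (cong orient (walk-≋ (base-Arc2 i) suc-j≋))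
                 (trans (cong (λ z → orient (walk (base z) (toℕ (proj₂ (locate Q))))) same-cycle) (at-locate Q))

  mCn⇒gimel : ∀ P Q → mCnAdj (locate P) (locate Q) → GimelAdj Γ Δ P Q
  mCn⇒gimel P Q (same , inj₁ forward) =
    let (α , d , P~ , Q~) = consecutive-Δ P Q same forward in α , d , inj₁ (P~ , Q~)
  mCn⇒gimel P Q (same , inj₂ backward) =
    let (α , d , Q~ , P~) = consecutive-Δ Q P (sym same) backward in α , d , inj₂ (Q~ , P~)

  gimel-iso : GraphIso (Path2 Γ) (Fin m × Fin n) (GimelAdj Γ Δ) mCnAdj
  gimel-iso = locate , ↔-bijective Path2-↔-cycles , λ P Q → mk⇔ (gimel⇒mCn P Q) (mCn⇒gimel P Q)

module Family {c ℓ} (S : Setting c ℓ) where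
  open Setting S
  open Action A
  open FiniteCounting
  open GraphFacts Γ
  open ActionFacts A
  open Successor S
  open Period S
  open Cycles S
  open Canonical S

  ℰ : Fin m → EdgeSet N
  ℰ i = cycleEdges (base i)

  ℰ-IsNCycle : ∀ i → IsNCycle Γ n (ℰ i)
  ℰ-IsNCycle i = cycleEdges-IsNCycle (base-Arc2 i)

  cycleEdges-cycleOf : ∀ t p u w → cycleEdges t u w ≡ ℰ (cycleOf t p) u w
  cycleEdges-cycleOf t p u w = trans (cycleEdges-SameCycle p (OnCycle⇒SameCycle (canonical-OnCycle t)) u w)
                                     (cong (λ r → cycleEdges r u w) (sym (base-cycleOf t p)))

  PathIn⇒cycleOf : ∀ i {t} (p : Arc2 Γ t) → PathIn Γ (ℰ i) t → cycleOf t p ≡ i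
  PathIn⇒cycleOf i {a , b , c} p (ab , bc)
    with cycle-segment (base-Arc2 i) (proj₂ (proj₂ p))
           (cycleEdges⇒CycleEdge (base-Arc2 i) ab) (cycleEdges⇒CycleEdge (base-Arc2 i) bc)
  ... | k , inj₁ e = cycleOf-unique _ p i k (cong orient (sym e))
  ... | k , inj₂ e = cycleOf-unique _ p i k (trans (cong orient (sym e)) (orient-rev p))

  ℰ-distinct : ∀ i j → i ≢ j → ¬ (∀ u w → ℰ i u w ≡ ℰ j u w)
  ℰ-distinct i j i≢j same = i≢j (trans (sym on-i) on-j)
    where
    p = base-Arc2 j
    edge : ∀ k → T (ℰ i (vert (base j) k) (vert (base j) (suc k)))
    edge k = subst T (sym (same _ _)) (cycleEdges-walk p k)
    on-i : cycleOf (base j) p ≡ i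
    on-i = PathIn⇒cycleOf i p (edge 0 , edge 1)
    on-j : cycleOf (base j) p ≡ j
    on-j = cycleOf-unique _ p j 0 refl

  SameEdge-act : ∀ g {u w a b} → SameEdge u w a b → SameEdge (act g u) (act g w) (act g a) (act g b)
  SameEdge-act g (inj₁ (refl , refl)) = inj₁ (refl , refl)
  SameEdge-act g (inj₂ (refl , refl)) = inj₂ (refl , refl)

  SameEdge-act⁻ : ∀ g {u w a b} → SameEdge (act g u) (act g w) (act g a) (act g b) → SameEdge u w a b
  SameEdge-act⁻ g (inj₁ (e , f)) = inj₁ (act-injective g e , act-injective g f)
  SameEdge-act⁻ g (inj₂ (e , f)) = inj₂ (act-injective g e , act-injective g f)

  cycleEdges-act : ∀ g {t} → Arc2 Γ t → ∀ u w → cycleEdges t u w ≡ cycleEdges (act3 A g t) (act g u) (act g w)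
  cycleEdges-act g {t} p u w = T-extensional
    (λ e → CycleEdge⇒cycleEdges gp (to (cycleEdges⇒CycleEdge p e)))
    (λ e → CycleEdge⇒cycleEdges p (from (cycleEdges⇒CycleEdge gp e)))
    where
    gp : Arc2 Γ (act3 A g t)
    gp = Arc2-act g p
    moved : ∀ k → vert (act3 A g t) k ≡ act g (vert t k)
    moved = vert-equivariant g p
    to : CycleEdge t u w → CycleEdge (act3 A g t) (act g u) (act g w)
    to (k , e) = k , subst₂ (SameEdge (act g u) (act g w)) (sym (moved k)) (sym (moved (suc k))) (SameEdge-act g e)
    from : CycleEdge (act3 A g t) (act g u) (act g w) → CycleEdge t u w
    from (k , e) = k , SameEdge-act⁻ g (subst₂ (SameEdge (act g u) (act g w)) (moved k) (moved (suc k)) e)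

  ℰ-orbit : IsOrbitFamily A ℰ
  ℰ-orbit = (λ g i → let p = Arc2-act g (base-Arc2 i) in
                       cycleOf _ p , λ u w → trans (cycleEdges-act g (base-Arc2 i) u w) (cycleEdges-cycleOf _ p _ _)) ,
            (λ i j → let (g , e) = two-arc-transitive (base i) (base j) (base-Arc2 i) (base-Arc2 j) in
                       g , λ u w → trans (cycleEdges-act g (base-Arc2 i) u w) (cong (λ r → cycleEdges r (act g u) (act g w)) e))

  ℰ-unique : UniqueContainment Γ ℰ
  ℰ-unique t p = cycleOf t p , (edge 0 , edge 1) , λ j on-j → sym (PathIn⇒cycleOf j p on-j)
    where
    edge : ∀ k → T (ℰ (cycleOf t p) (vert t k) (vert t (suc k)))
    edge k = subst T (cycleEdges-cycleOf t p _ _) (cycleEdges-walk p k)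

  Δ-along : ∀ {r} → Arc2 Γ r → ∀ k {a b c d} → a ≡ vert r k → b ≡ vert r (suc k) →
    c ≡ vert r (suc (suc k)) → d ≡ vert r (suc (suc (suc k))) → Δ (a , b , c , d)
  Δ-along p k refl refl refl refl = Δ-extend (walk-Arc2 p k)

  Δ⇒ℰ : ∀ α → Δ α → ∃[ i ] Arc3In Γ (ℰ i) α
  Δ⇒ℰ (a , b , c , d) δ∈ = cycleOf s p , edge 0 , edge 1 , subst (T ∘ ℰ (cycleOf s p) c) (sym d≡) (edge 2) , a≢c , b≢d
    where
    s : Triple N
    s = (a , b , c)
    arc : Arc3 Γ (a , b , c , d)
    arc = Δ-Arc3 δ∈
    a≢c : a ≢ c
    a≢c = proj₁ (proj₂ (proj₂ (proj₂ arc)))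
    b≢d : b ≢ d
    b≢d = proj₂ (proj₂ (proj₂ (proj₂ arc)))
    p : Arc2 Γ s
    p = proj₁ arc , proj₁ (proj₂ arc) , a≢c
    d≡ : d ≡ nextVertex s
    d≡ = Δ-nextVertex δ∈
    edge : ∀ k → T (ℰ (cycleOf s p) (vert s k) (vert s (suc k)))
    edge k = subst T (cycleEdges-cycleOf s p _ _) (cycleEdges-walk p k)

  ℰ⇒Δ : ∀ α → ∃[ i ] Arc3In Γ (ℰ i) α → Δ α
  ℰ⇒Δ (a , b , c , d) (i , ab , bc , cd , a≢c , b≢d) = along (cycle-segment r a≢c (edge ab) (edge bc))
    where
    R : Triple N
    R = base i
    r : Arc2 Γ R
    r = base-Arc2 i
    edge : ∀ {u w} → T (ℰ i u w) → CycleEdge R u w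
    edge = cycleEdges⇒CycleEdge r
    along : ∃[ k ] ((a , b , c) ≡ walk R k ⊎ (c , b , a) ≡ walk R k) → Δ (a , b , c , d)
    along (k , inj₁ e) = Δ-along r k (cong proj₁ e) b≡ c≡ d≡
      where
      b≡ : b ≡ vert R (suc k)
      b≡ = cong (proj₁ ∘ proj₂) e
      c≡ : c ≡ vert R (suc (suc k))
      c≡ = cong (proj₂ ∘ proj₂) e
      d≡ : d ≡ vert R (suc (suc (suc k)))
      d≡ with cycle-neighbours r (suc (suc k)) (subst (λ z → CycleEdge R z d) c≡ (edge cd))
      ... | inj₁ forward = forward
      ... | inj₂ back = ⊥-elim (b≢d (trans b≡ (trans (vert-≋ r (sym (prev-suc (suc k)))) (sym back))))
    along (k , inj₂ e) = self-paired d c b a (Δ-along r (prev k) d≡ c≡ b≡ a≡)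
      where
      realign : ∀ j → (j + k) ≋ (j + suc (prev k))
      realign j = ≋-+ˡ j (sym (suc-prev k))
      c≡ : c ≡ vert R (suc (prev k))
      c≡ = trans (cong proj₁ e) (vert-≋ r (realign 0))
      b≡ : b ≡ vert R (suc (suc (prev k)))
      b≡ = trans (cong (proj₁ ∘ proj₂) e) (vert-≋ r (realign 1))
      a≡ : a ≡ vert R (suc (suc (suc (prev k))))
      a≡ = trans (cong (proj₂ ∘ proj₂) e) (vert-≋ r (realign 2))
      d≡ : d ≡ vert R (prev k)
      d≡ with cycle-neighbours r k (subst (λ z → CycleEdge R z d) (cong proj₁ e) (edge cd))
      ... | inj₁ forward = ⊥-elim (b≢d (trans (cong (proj₁ ∘ proj₂) e) (sym forward)))
      ... | inj₂ back = back

  Δ⇔ℰ : ∀ α → Δ α ⇔ (∃[ i ] Arc3In Γ (ℰ i) α)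
  Δ⇔ℰ α = mk⇔ (Δ⇒ℰ α) (ℰ⇒Δ α)

module Counting {c ℓ} (S : Setting c ℓ) {v : ℕ} (regular : Regular (Setting.Γ S) v) where
  open Setting S
  open Graph Γ using (adj)
  open FiniteCounting
  open GraphFacts Γ
  open Successor S
  open Period S
  open Canonical S
  open PathIndex S

  -- the number of 2-paths through a vertex
  C : ℕ
  C = (v * (v ∸ 1)) / 2

  twice-C : 2 * C ≡ v * (v ∸ 1)
  twice-C = trans (cong (2 *_) (sym (pairs-regular regular (proj₁ δ))))
                  (trans (pairs-count (adj (proj₁ δ))) (cong (λ k → k * (k ∸ 1)) (regular (proj₁ δ))))

  -- both sides count the 2-paths
  mn≡NC : m * n ≡ N * C
  mn≡NC = ↔⇒≡ (↔-trans FP.*↔× (↔-trans (↔-sym Path2-↔-cycles) (Path2-count regular)))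

  mn≡Nv[v-1]/2 : m * n ≡ (N * v * (v ∸ 1)) / 2
  mn≡Nv[v-1]/2 = begin
    m * n                 ≡⟨ mn≡NC ⟩
    N * C                 ≡⟨ sym (m*n/n≡m (N * C) 2) ⟩
    (N * C * 2) / 2       ≡⟨ cong (_/ 2) N*C*2≡ ⟩
    (N * v * (v ∸ 1)) / 2 ∎
    where
    open ≡-Reasoning
    N*C*2≡ : N * C * 2 ≡ N * v * (v ∸ 1)
    N*C*2≡ = trans (*-assoc N C 2) (trans (cong (N *_) (trans (*-comm C 2) twice-C)) (sym (*-assoc N v (v ∸ 1))))

  mn≡e[v-1] : m * n ≡ numEdges Γ * (v ∸ 1)
  mn≡e[v-1] = *-cancelˡ-≡ (m * n) (numEdges Γ * (v ∸ 1)) 2 (begin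
    2 * (m * n)                        ≡⟨ cong (2 *_) mn≡NC ⟩
    2 * (N * C)                        ≡⟨ *-comm-middle 2 N C ⟩
    N * (2 * C)                        ≡⟨ cong (N *_) twice-C ⟩
    N * (v * (v ∸ 1))                  ≡⟨ sym (*-assoc N v (v ∸ 1)) ⟩
    N * v * (v ∸ 1)                    ≡⟨ cong (_* (v ∸ 1)) (sym (twice-numEdges-regular regular)) ⟩
    (numEdges Γ + numEdges Γ) * (v ∸ 1) ≡⟨ cong (λ k → (numEdges Γ + k) * (v ∸ 1)) (sym (+-identityʳ _)) ⟩
    2 * numEdges Γ * (v ∸ 1)           ≡⟨ *-assoc 2 (numEdges Γ) (v ∸ 1) ⟩
    2 * (numEdges Γ * (v ∸ 1))         ∎)
    where
    open ≡-Reasoning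
    *-comm-middle : ∀ a b c → a * (b * c) ≡ b * (a * c)
    *-comm-middle a b c = trans (sym (*-assoc a b c)) (trans (cong (_* c) (*-comm a b)) (*-assoc b a c))

  same-cycle-same-middle : ∀ P Q → proj₁ (locate P) ≡ proj₁ (locate Q) →
    middle (proj₁ P) ≡ middle (proj₁ Q) → proj₁ P ≡ proj₁ Q
  same-cycle-same-middle P Q same-cycle same-middle = begin
      proj₁ P                        ≡⟨ sym (at-locate P) ⟩
      orient (walk (base i) j)       ≡⟨ cong orient (walk-≋ (base-Arc2 i) j≋j′) ⟩
      orient (walk (base i) j′)      ≡⟨ cong (λ z → orient (walk (base z) j′)) same-cycle ⟩
      orient (walk (base i′) j′)     ≡⟨ at-locate Q ⟩
      proj₁ Q                        ∎
    where
    open ≡-Reasoning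
    i i′ : Fin m
    i = proj₁ (locate P)
    i′ = proj₁ (locate Q)
    j j′ : ℕ
    j = toℕ (proj₂ (locate P))
    j′ = toℕ (proj₂ (locate Q))
    middle-at : ∀ R → middle (orient (walk (base (proj₁ (locate R))) (toℕ (proj₂ (locate R))))) ≡ middle (proj₁ R)
    middle-at R = cong middle (at-locate R)
    j≋j′ : j ≋ j′
    j≋j′ = ≋-cancel 1 (trans (≡⇒≋ (+-comm j 1)) (trans (≋-vert (base-Arc2 i) {suc j} {suc j′} same-vertex)
                                                   (≡⇒≋ (+-comm 1 j′))))
      where
      same-vertex : vert (base i) (suc j) ≡ vert (base i) (suc j′)
      same-vertex = begin
        vert (base i) (suc j)               ≡⟨ sym (orient-middle (walk (base i) j)) ⟩
        middle (orient (walk (base i) j))   ≡⟨ trans (middle-at P) (trans same-middle (sym (middle-at Q))) ⟩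
        middle (orient (walk (base i′) j′)) ≡⟨ cong (λ z → middle (orient (walk (base z) j′))) (sym same-cycle) ⟩
        middle (orient (walk (base i) j′))  ≡⟨ orient-middle (walk (base i) j′) ⟩
        vert (base i) (suc j′)              ∎

  -- so the C 2-paths through a vertex lie on distinct cycles
  C≤m : C ≤ m
  C≤m = subst (_≤ m) (pairs-regular regular b) (FP.injective⇒≤ {f = cycle-of-pair} injective)
    where
    b : Fin N
    b = proj₁ δ
    pair : Fin (pairs (adj b)) → Path2 Γ
    pair k = path-through (Inverse.from (PathsThrough-↔ b) k)
    cycle-of-pair : Fin (pairs (adj b)) → Fin m
    cycle-of-pair = proj₁ ∘ locate ∘ pair
    injective : ∀ {k k′} → cycle-of-pair k ≡ cycle-of-pair k′ → k ≡ k′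
    injective {k} {k′} e = ↔-injective (↔-sym (PathsThrough-↔ b))
      (path-through-injective (same-cycle-same-middle (pair k) (pair k′) e refl))

module Shape {c ℓ} (S : Setting c ℓ) where
  open Setting S
  open Action A
  open GraphFacts Γ
  open ActionFacts A
  open Successor S
  open Period S
  open Cycles S
  open Family S

  -- If g fixes u and all its neighbours, then g fixes every neighbour of
  -- each neighbour w of u: a neighbour y ≠ u of w extends the 2-arc (y,w,u)
  -- to (y,w,u,z) ∈ Δ, and ℓ₁(Δ) = 1 applied to the reverse (z,u,w,y) fixes y.
  fixes-next-neighbourhood : ∀ g {u w} → Adj Γ u w →
    act g u ≡ u → (∀ x → Adj Γ u x → act g x ≡ x) → ∀ y → Adj Γ w y → act g y ≡ y
  fixes-next-neighbourhood g {u} {w} uw fix-u fix-Nu y wy with y F.≟ u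
  ... | yes refl = fix-u
  ... | no y≢u = ell₁ z u w y reversed g (fix-Nu z (Adj-sym (proj₁ (Δ-Arc3 reversed)))) fix-u (fix-Nu w uw)
    where
    z : Fin N
    z = nextVertex (y , w , u)
    reversed : Δ (z , u , w , y)
    reversed = self-paired y w u z (Δ-extend (Adj-sym wy , Adj-sym uw , y≢u))

  stabiliser-faithful : Connected Γ → FaithfulOnV A → StabFaithfulOnNbhd A
  stabiliser-faithful conn faithful τ g fix-τ fix-Nτ = faithful g (λ u → proj₁ (spread (conn τ u) (fix-τ , fix-Nτ)))
    where
    Fixed : Fin N → Set
    Fixed u = act g u ≡ u × (∀ w → Adj Γ u w → act g w ≡ w)
    spread : ∀ {u x} → Reach Γ u x → Fixed u → Fixed x
    spread here fixed = fixed
    spread (step uw rest) (fix-u , fix-Nu) =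
      spread rest (fix-Nu _ uw , fixes-next-neighbourhood g uw fix-u fix-Nu)

  HasCycle-n : HasCycle Γ n
  HasCycle-n = let (3≤n , cyc , injective , adjacent , _) = cycleEdges-IsNCycle δ-Arc2 in
               3≤n , cyc , injective , adjacent

  girth : ℕ
  girth = proj₁ (girth-exists HasCycle-n)

  girth-IsGirth : IsGirth Γ girth
  girth-IsGirth = proj₁ (proj₂ (girth-exists HasCycle-n))

  girth≤n : girth ≤ n
  girth≤n = proj₂ (proj₂ (girth-exists HasCycle-n))

  3≤girth : 3 ≤ girth
  3≤girth = proj₁ (proj₁ girth-IsGirth)

  complete-or-near-polygonal : Connected Γ → ∀ {v} → Regular Γ v →
    GraphIso (Fin N) (Fin (suc v)) (Adj Γ) KAdj ⊎ (4 ≤ girth × NearPolygonal Γ n ℰ)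
  complete-or-near-polygonal conn regular with 4 ≤? girth
  ... | yes 4≤g = inj₂ (4≤g , conn , (girth , girth-IsGirth , 4≤g) , ℰ-IsNCycle , ℰ-unique)
  ... | no 4≰g = inj₁ (complete-regular regular (proj₁ δ)
                   (triangle-complete conn two-arc-transitive (subst (HasCycle Γ) girth≡3 (proj₁ girth-IsGirth))))
    where
    girth≡3 : girth ≡ 3
    girth≡3 = ≤-antisym (≤-pred (≰⇒> 4≰g)) 3≤girth

-- An element g mapping C onto C moves the cycle rigidly: it is determined on
-- V(C) by the position k of the image of the first vertex and by whether it
-- reverses the direction, acting on positions as j ↦ k ± j.  This classifies
-- g by (k, ±) ∈ D_{2n}; the classification is a homomorphism whose fibres are
-- the cosets of the pointwise stabiliser, and 2-arc-transitivity makes it onto.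
module Dihedral {c ℓ} (S : Setting c ℓ) where
  open Setting S
  open Group X using (Carrier; _∙_)
  open Action A
  open GraphFacts Γ
  open ActionFacts A
  open Successor S
  open Period S
  open Cycles S
  open Canonical S
  open Family S

  module Symmetries (i : Fin m) where
    r : Triple N
    r = base i
    p : Arc2 Γ r
    p = base-Arc2 i

    abstract
      search : ∀ u → Dec (∃ λ (j : Fin n) → vert r (toℕ j) ≡ u) → Fin n
      search u (yes (j , _)) = j
      search u (no _) = 0 mod n

      place : Fin N → Fin n
      place u = search u (FP.any? (λ j → vert r (toℕ j) F.≟ u))

      search-spec : ∀ u q → u ≡ vert r q → (d : Dec (∃ λ (j : Fin n) → vert r (toℕ j) ≡ u)) → vert r (toℕ (search u d)) ≡ u
      search-spec u q e (yes (j , e′)) = e′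
      search-spec u q e (no none) =
        ⊥-elim (none (q mod n , trans (cong (vert r) (toℕ-mod q)) (trans (vert-≋ p (≋-mod q)) (sym e))))

      place-spec : ∀ u q → u ≡ vert r q → vert r (toℕ (place u)) ≡ u
      place-spec u q e = search-spec u q e (FP.any? (λ j → vert r (toℕ j) F.≟ u))

    -- the symmetry of D_{2n} sending (v₀, v₁) to (u₀, u₁)
    classify : Fin N → Fin N → Dih n
    classify u₀ u₁ = place u₀ , not (does (u₁ F.≟ vert r (suc (toℕ (place u₀)))))

    φ : (g : Carrier) → MapsOnto A g (ℰ i) (ℰ i) → Dih n
    φ g _ = classify (act g (vert r 0)) (act g (vert r 1))

    Moves : Carrier → Dih n → Set
    Moves g (k , s) = ∀ j → act g (vert r j) ≡ vert r (dihedralMap s (toℕ k) j)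

    edge-image : ∀ g → MapsOnto A g (ℰ i) (ℰ i) → ∀ {u w} → CycleEdge r u w → CycleEdge r (act g u) (act g w)
    edge-image g onto e = cycleEdges⇒CycleEdge p (subst T (onto _ _) (CycleEdge⇒cycleEdges p e))

    first-edge : CycleEdge r (vert r 0) (vert r 1)
    first-edge = 0 , inj₁ (refl , refl)

    -- g is determined on the cycle by the images of two consecutive vertices
    propagate : ∀ g → MapsOnto A g (ℰ i) (ℰ i) → ∀ s k j →
      act g (vert r j) ≡ vert r (dihedralMap s k j) → act g (vert r (suc j)) ≡ vert r (dihedralMap s k (suc j)) →
      act g (vert r (suc (suc j))) ≡ vert r (dihedralMap s k (suc (suc j)))
    propagate g onto s k j at-j at-suc-j =
      along s at-j (cycle-neighbours p (dihedralMap s k (suc j))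
                      (subst (λ z → CycleEdge r z u) at-suc-j (edge-image g onto (suc j , inj₁ (refl , refl)))))
      where
      u : Fin N
      u = act g (vert r (suc (suc j)))
      not-back : u ≢ act g (vert r j)
      not-back e = vert-≢₂ p j (sym (act-injective g e))
      along : ∀ s → act g (vert r j) ≡ vert r (dihedralMap s k j) →
        u ≡ vert r (suc (dihedralMap s k (suc j))) ⊎ u ≡ vert r (prev (dihedralMap s k (suc j))) →
        u ≡ vert r (dihedralMap s k (suc (suc j)))
      along false _ (inj₁ e) = trans e (cong (vert r) (sym (+-suc k (suc j))))
      along false at-j (inj₂ e) = ⊥-elim (not-back (trans e (trans (vert-≋ p back) (sym at-j))))
        where
        back : prev (k + suc j) ≋ k + j
        back = trans (cong (λ z → prev z % n) (+-suc k j)) (prev-suc (k + j))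
      along true at-j (inj₁ e) = ⊥-elim (not-back (trans e (trans (vert-≋ p back) (sym at-j))))
        where
        back : suc (k + ν * suc j) ≋ k + ν * j
        back = trans (cong (λ z → suc z % n) (ring₁ k ν j)) (suc-prev (k + ν * j))
          where
          ring₁ : ∀ k ν j → k + ν * suc j ≡ k + ν * j + ν
          ring₁ = solve-∀
      along true _ (inj₂ e) = trans e (cong (vert r) (ring₂ k ν j))
        where
        ring₂ : ∀ k ν j → k + ν * suc j + ν ≡ k + ν * suc (suc j)
        ring₂ = solve-∀

    module _ (g : Carrier) (onto : MapsOnto A g (ℰ i) (ℰ i)) where
      start : ℕ
      start = toℕ (place (act g (vert r 0)))

      first : act g (vert r 0) ≡ vert r start
      first = let (q , e) = CycleEdge-vert (edge-image g onto first-edge) in sym (place-spec _ q e)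

      -- the image of the second vertex fixes the direction
      second : (d : Dec (act g (vert r 1) ≡ vert r (suc start))) → act g (vert r 1) ≡ vert r (dihedralMap (not (does d)) start 1)
      second (yes e) = trans e (cong (vert r) (+-comm 1 start))
      second (no ≢next) = backwards (cycle-neighbours p start (subst (λ z → CycleEdge r z (act g (vert r 1))) first
                                                                (edge-image g onto first-edge)))
        where
        backwards : act g (vert r 1) ≡ vert r (suc start) ⊎ act g (vert r 1) ≡ vert r (prev start) →
          act g (vert r 1) ≡ vert r (start + ν * 1)
        backwards (inj₁ e) = ⊥-elim (≢next e)
        backwards (inj₂ e) = trans e (cong (λ z → vert r (start + z)) (sym (*-identityʳ ν)))

      motion : Moves g (φ g onto)
      motion j = proj₁ (pair j)
        where
        s : Bool
        s = proj₂ (φ g onto)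
        pair : ∀ j → act g (vert r j) ≡ vert r (dihedralMap s start j) × act g (vert r (suc j)) ≡ vert r (dihedralMap s start (suc j))
        pair zero = trans first (cong (vert r) (sym (dihedralMap-0 s start))) , second (act g (vert r 1) F.≟ vert r (suc start))
        pair (suc j) = proj₂ (pair j) , propagate g onto s start j (proj₁ (pair j)) (proj₂ (pair j))

    -- j ↦ k - j and j ↦ k + 1 + j differ at j = 1, as n ≠ 2
    reflection≢rotation : ∀ k → vert r (k + ν * 1) ≢ vert r (suc k)
    reflection≢rotation k e = <-irrefl (sym n≡2) (≤-trans (s≤s (s≤s (s≤s z≤n))) 3≤n)
      where
      ν≋1 : ν ≋ 1
      ν≋1 = trans (≡⇒≋ (sym (*-identityʳ ν)))
              (≋-cancel k (trans (≡⇒≋ (+-comm (ν * 1) k)) (≋-vert p {k + ν * 1} {suc k} e)))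
      n≡2 : n ≡ 2
      n≡2 = trans (sym suc-ν) (cong suc (trans (sym (m<n⇒m%n≡m ν<n)) (trans ν≋1 (m<n⇒m%n≡m (≤-trans (s≤s (s≤s z≤n)) 3≤n)))))

    φ-unique : ∀ g onto d → Moves g d → φ g onto ≡ d
    φ-unique g onto (k , s) moves =
      cong₂ _,_ same-place (trans (cong (λ z → not (does (act g (vert r 1) F.≟ vert r (suc (toℕ z))))) same-place)
                                  (direction s (moves 1)))
      where
      at-0 : act g (vert r 0) ≡ vert r (toℕ k)
      at-0 = trans (moves 0) (cong (vert r) (dihedralMap-0 s (toℕ k)))
      same-place : place (act g (vert r 0)) ≡ k
      same-place = Fin-≋ _ k (≋-vert p (trans (place-spec _ (toℕ k) at-0) at-0))
      direction : ∀ s → act g (vert r 1) ≡ vert r (dihedralMap s (toℕ k) 1) →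
        not (does (act g (vert r 1) F.≟ vert r (suc (toℕ k)))) ≡ s
      direction false e = cong not (dec-true (_ F.≟ _) (trans e (cong (vert r) (+-comm (toℕ k) 1))))
      direction true e = cong not (dec-false (_ F.≟ _) (λ e′ → reflection≢rotation (toℕ k) (trans (sym e) e′)))

    φ-hom : ∀ g h onto-g onto-h onto-gh → φ (g ∙ h) onto-gh ≡ dmul (φ g onto-g) (φ h onto-h)
    φ-hom g h onto-g onto-h onto-gh = φ-unique (g ∙ h) onto-gh _ λ j → begin
        act (g ∙ h) (vert r j)                             ≡⟨ act-∙ g h (vert r j) ⟩
        act g (act h (vert r j))                           ≡⟨ cong (act g) (motion h onto-h j) ⟩
        act g (vert r (dihedralMap s′ (toℕ k′) j))         ≡⟨ motion g onto-g _ ⟩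
        vert r (dihedralMap s (toℕ k) (dihedralMap s′ (toℕ k′) j)) ≡⟨ vert-≋ p (dihedralMap-∘ s k s′ k′ j) ⟩
        vert r (dihedralMap (s xor s′) (toℕ (addF k (if s then negF k′ else k′))) j) ∎
      where
      open ≡-Reasoning
      k k′ : Fin n
      k = proj₁ (φ g onto-g)
      k′ = proj₁ (φ h onto-h)
      s s′ : Bool
      s = proj₂ (φ g onto-g)
      s′ = proj₂ (φ h onto-h)

    InV-vert : ∀ {u} → InV Γ (ℰ i) u → ∃[ q ] u ≡ vert r q
    InV-vert (w , e) = CycleEdge-vert (cycleEdges⇒CycleEdge p e)

    φ-fibres : ∀ g h onto-g onto-h → (φ g onto-g ≡ φ h onto-h) ⇔ (∀ u → InV Γ (ℰ i) u → act g u ≡ act h u)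
    φ-fibres g h onto-g onto-h = mk⇔ agree same-class
      where
      agree : φ g onto-g ≡ φ h onto-h → ∀ u → InV Γ (ℰ i) u → act g u ≡ act h u
      agree e u on with InV-vert on
      ... | q , refl = trans (motion g onto-g q)
        (trans (cong (λ d → vert r (dihedralMap (proj₂ d) (toℕ (proj₁ d)) q)) e) (sym (motion h onto-h q)))
      same-class : (∀ u → InV Γ (ℰ i) u → act g u ≡ act h u) → φ g onto-g ≡ φ h onto-h
      same-class same = cong₂ classify (same (vert r 0) (vert r 1 , cycleEdges-walk p 0))
                                       (same (vert r 1) (vert r 2 , cycleEdges-walk p 1))

    onto-cycle : ∀ g {t} → SameCycle r t → act3 A g r ≡ t → MapsOnto A g (ℰ i) (ℰ i)
    onto-cycle g same e u w = trans (cycleEdges-act g p u w)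
      (trans (cong (λ z → cycleEdges z (act g u) (act g w)) e) (sym (cycleEdges-SameCycle p same _ _)))

    -- rotations and reflections are realised by 2-arc-transitivity
    φ-onto : ∀ d → ∃[ g ] Σ (MapsOnto A g (ℰ i) (ℰ i)) λ onto → φ g onto ≡ d
    φ-onto (k , false) =
      let (g , e) = two-arc-transitive r (walk r K) p (walk-Arc2 p K)
          onto = onto-cycle g (K , inj₁ refl) e
      in g , onto , φ-unique g onto (k , false) λ j → begin
        act g (vert r j)        ≡⟨ sym (vert-equivariant g p j) ⟩
        vert (act3 A g r) j     ≡⟨ cong (λ z → vert z j) e ⟩
        vert (walk r K) j       ≡⟨ cong proj₁ (sym (walk-+ r j K)) ⟩
        vert r (j + K)          ≡⟨ cong (vert r) (+-comm j K) ⟩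
        vert r (K + j)          ∎
      where
      open ≡-Reasoning
      K : ℕ
      K = toℕ k
    φ-onto (k , true) =
      let (g , e) = two-arc-transitive r (rev (walk r K′)) p (Arc2-rev (walk-Arc2 p K′))
          onto = onto-cycle g (K′ , inj₂ refl) e
      in g , onto , φ-unique g onto (k , true) λ j → begin
        act g (vert r j)                   ≡⟨ sym (vert-equivariant g p j) ⟩
        vert (act3 A g r) j                ≡⟨ cong (λ z → vert z j) e ⟩
        vert (rev (walk r K′)) j           ≡⟨ cong proj₁ (proj₂ (proj₂ (walk-rev-≋ p K′ j))) ⟩
        vert r (2 + proj₁ (walk-rev-≋ p K′ j)) ≡⟨ vert-≋ p (reflected j) ⟩
        vert r (K + ν * j)                 ∎
      where
      open ≡-Reasoning
      K K′ : ℕ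
      K = toℕ k
      K′ = offset 2 K
      -- position j of the reversed walk is position K - j of the cycle
      reflected : ∀ j → 2 + proj₁ (walk-rev-≋ p K′ j) ≋ K + ν * j
      reflected j = ≋-cancel j (begin
        (2 + i′ + j) % n        ≡⟨ cong (_% n) (+-assoc 2 i′ j) ⟩
        (2 + (i′ + j)) % n      ≡⟨ ≋-+ˡ 2 (proj₁ (proj₂ (walk-rev-≋ p K′ j))) ⟩
        (2 + K′) % n            ≡⟨ offset-≋ 2 K ⟩
        K % n                   ≡⟨ cong (_% n) (sym (+-identityʳ K)) ⟩
        (K + 0) % n             ≡⟨ sym (≋-+ˡ K (ν*-inverse j)) ⟩
        (K + (ν * j + j)) % n   ≡⟨ cong (_% n) (sym (+-assoc K (ν * j) j)) ⟩
        (K + ν * j + j) % n     ∎)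
        where
        i′ : ℕ
        i′ = proj₁ (walk-rev-≋ p K′ j)

  ℰ-dihedral : ∀ i → InducedDihedral A n (ℰ i)
  ℰ-dihedral i = φ , φ-hom , φ-fibres , φ-onto
    where open Symmetries i

theorem5p2 : ∀ {c ℓ} (X : Group c ℓ) (N : ℕ) (Γ : Graph N) (A : Action X Γ)
    (v : ℕ) (Δ : Quad N → Set) →
    Connected Γ → VertexTransitive A → TwoArcTransitive A →
    Regular Γ v → 3 ≤ v →
    IsArc3Orbit A Δ → SelfPaired A Δ → Ell1IsOne A Δ →
    (FaithfulOnV A → StabFaithfulOnNbhd A) ×
    ∃[ m ] ∃[ n ] ∃[ g ] (
      GraphIso (Path2 Γ) (Fin m × Fin n) (GimelAdj Γ Δ) mCnAdj ×
      (v * (v ∸ 1)) / 2 ≤ m × IsGirth Γ g × g ≤ n × 3 ≤ g ×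
      m * n ≡ (N * v * (v ∸ 1)) / 2 × m * n ≡ numEdges Γ * (v ∸ 1) ×
      Σ (Fin m → EdgeSet N) (λ ℰ →
        (∀ i → IsNCycle Γ n (ℰ i)) ×
        (∀ i j → i ≢ j → ¬ (∀ u w → ℰ i u w ≡ ℰ j u w)) ×
        IsOrbitFamily A ℰ ×
        (∀ α → Δ α ⇔ (∃[ i ] Arc3In Γ (ℰ i) α)) ×
        (∀ i → InducedDihedral A n (ℰ i)) ×
        UniqueContainment Γ ℰ ×
        (GraphIso (Fin N) (Fin (suc v)) (Adj Γ) KAdj ⊎
          (4 ≤ g × NearPolygonal Γ n ℰ))))
theorem5p2 {c} {ℓ} X N Γ A v Δ connected _ two-arc-transitive regular _ orbit self-paired ell₁ =
  stabiliser-faithful connected ,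
  m , n , girth ,
  gimel-iso ,
  C≤m , girth-IsGirth , girth≤n , 3≤girth ,
  mn≡Nv[v-1]/2 , mn≡e[v-1] ,
  ℰ , ℰ-IsNCycle , ℰ-distinct , ℰ-orbit , Δ⇔ℰ , ℰ-dihedral , ℰ-unique ,
  complete-or-near-polygonal connected regular
  where
  S : Setting c ℓ
  S = record { X = X ; N = N ; Γ = Γ ; A = A ; Δ = Δ ; two-arc-transitive = two-arc-transitive
             ; orbit = orbit ; self-paired = self-paired ; ell₁ = ell₁ }
  open Period S using (n)
  open Canonical S using (m)
  open GimelIso S using (gimel-iso)
  open Counting S regular using (C≤m; mn≡Nv[v-1]/2; mn≡e[v-1])
  open Family S using (ℰ; ℰ-IsNCycle; ℰ-distinct; ℰ-orbit; Δ⇔ℰ; ℰ-unique)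
  open Dihedral S using (ℰ-dihedral)
  open Shape S using (stabiliser-faithful; girth; girth-IsGirth; girth≤n; 3≤girth; complete-or-near-polygonal)
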